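{- Let $D=\{\rho_1,\dots,\rho_{2k}\}\subseteq\mathbb{Q}$, $D_{2k}(x)=(x-\rho_1)\cdots(x-\rho_{2k})$, and let $\beta$ be the minimum number of bits needed to encode each coefficient of $D_{2k}$ and each $\rho_i$ (as reduced fractions in binary). There exists a positive rational number $t>\max_{i\in[2k]}\{2,|\rho_i|\}$ that can be encoded with $O(k\beta)$ bits such that there exist SoS proofs of degree $2k$ $$t-x=\sum_{i=1}^{2k+3}a_iq_i^2-D_{2k}(x),\qquad t+x=\sum_{i=1}^{2k+3}\tilde a_i\tilde q_i^2-D_{2k}(x),$$ for some nonnegative rational constants $a_i,\tilde a_i$ and polynomials $q_i,\tilde q_i\in\mathbb{Q}[x]$, where all coefficients in these representations can be encoded with $\mathrm{poly}(k,\beta)$ bits.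
   Context: An SoS proof of "$q\ge0$" from the equation $D_{2k}(x)=0$ is an identity $q=\sum_i c_is_i^2+hD_{2k}(x)$ with nonnegative constants $c_i$ and polynomials $s_i,h$; its degree is the maximum degree of the summands. -}

module Defs where

open import Data.Nat as ℕ using (ℕ; zero; suc)
open import Data.Nat.Logarithm using (⌊log₂_⌋)
open import Data.Integer as ℤ using (ℤ)
open import Data.Fin using (Fin)
import Data.Fin as Fin
open import Data.List using (List; []; _∷_)
open import Data.Rational as ℚ using (ℚ; 0ℚ; 1ℚ; ↥_; ↧ₙ_)
open import Relation.Binary.PropositionalEquality using (_≡_)

-- Univariate polynomials over ℚ, as coefficient lists (lowest degree
-- first).  Two lists denote the same polynomial iff all coefficients agree
-- (trailing zeros are irrelevant), see _≈P_.

Poly : Set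
Poly = List ℚ

coeff : Poly → ℕ → ℚ
coeff []       _       = 0ℚ
coeff (c ∷ p)  zero    = c
coeff (c ∷ p)  (suc n) = coeff p n

_≈P_ : Poly → Poly → Set
p ≈P q = ∀ n → coeff p n ≡ coeff q n

DegLe : Poly → ℕ → Set
DegLe p d = ∀ n → d ℕ.< n → coeff p n ≡ 0ℚ

const : ℚ → Poly
const c = c ∷ []

X : Poly
X = 0ℚ ∷ 1ℚ ∷ []

_+P_ : Poly → Poly → Poly
[]      +P q       = q
(a ∷ p) +P []      = a ∷ p
(a ∷ p) +P (b ∷ q) = (a ℚ.+ b) ∷ (p +P q)

scale : ℚ → Poly → Poly
scale c []      = []
scale c (a ∷ p) = (c ℚ.* a) ∷ scale c p

negP : Poly → Poly
negP = scale (ℚ.- 1ℚ)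

_-P_ : Poly → Poly → Poly
p -P q = p +P negP q

_*P_ : Poly → Poly → Poly
[]      *P q = []
(a ∷ p) *P q = scale a q +P (0ℚ ∷ (p *P q))

sumP : (n : ℕ) → (Fin n → Poly) → Poly
sumP zero    f = []
sumP (suc n) f = f Fin.zero +P sumP n (λ i → f (Fin.suc i))

prodP : (n : ℕ) → (Fin n → Poly) → Poly
prodP zero    f = const 1ℚ
prodP (suc n) f = f Fin.zero *P prodP n (λ i → f (Fin.suc i))

rootPoly : (n : ℕ) → (Fin n → ℚ) → Poly
rootPoly n ρ = prodP n (λ i → X -P const (ρ i))

bitsℕ : ℕ → ℕ
bitsℕ zero    = 1
bitsℕ (suc n) = suc ⌊log₂ suc n ⌋

-- bits of a rational as a reduced fraction: sign bit + numerator + denominator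
bitsℚ : ℚ → ℕ
bitsℚ q = 1 ℕ.+ bitsℕ ℤ.∣ ↥ q ∣ ℕ.+ bitsℕ (↧ₙ q)

maxFin : (n : ℕ) → (Fin n → ℕ) → ℕ
maxFin zero    f = 0
maxFin (suc n) f = f Fin.zero ℕ.⊔ maxFin n (λ i → f (Fin.suc i))

beta : (n : ℕ) → (Fin n → ℚ) → ℕ
beta n ρ = maxFin (suc n) (λ j → bitsℚ (coeff (rootPoly n ρ) (Fin.toℕ j)))
           ℕ.⊔ maxFin n (λ i → bitsℚ (ρ i))

twoℚ : ℚ
twoℚ = 1ℚ ℚ.+ 1ℚ

{-# OPTIONS --safe #-}
-- Put P = L + D with L = t ∓ x.  Subtract from P the chain T = Σⱼ wⱼ x²ʲ (x² − u)² with weights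
-- wⱼ = u^(k−2−j)/2 − 1/8: its geometric part telescopes, so T takes at most u^k/2 from the constant
-- coefficient, at most 1/2 from the leading one, and adds at least u/4 to every even coefficient in
-- between.  With M = 2^β + 1 bounding the coefficients of D, u = (2M + 1)² and t = u^k, the rest
-- R = P − T is diagonally dominant, and completing squares two degrees at a time,
-- R = a (1 + h x)² + x² R′, gives k + 1 further squares whose pivots a stay ≥ M² (the last one > 0).
-- Everything is obtained from 2^β, u and the coefficients by O(k) field operations, hence has
-- polynomially many bits.
module Submission where

open import Defs
open import Data.Nat.Base as ℕ using (ℕ; zero; suc)
import Data.Nat.Properties as ℕ
open import Data.Integer.Base as ℤ using (-[1+_])
import Data.Integer.Properties as ℤ
open import Data.Rational.Base as ℚ using (ℚ; mkℚ; 0ℚ; 1ℚ; ½; ↥_; ↧_; ↧ₙ_)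
import Data.Rational.Properties as ℚ
open import Data.Rational.Literals using (fromℤ)
open import Data.Fin.Base as Fin using (Fin; toℕ; fromℕ<)
import Data.Fin.Properties as Fin
open import Data.List.Base using ([]; _∷_)
open import Data.Sum.Base using (inj₁; inj₂)
open import Data.Product.Base using (Σ; _×_; _,_; proj₁; proj₂)
open import Data.Empty using (⊥-elim)
open import Function.Base using (_∘_)
open import Function.Definitions using (Injective)
open import Relation.Binary.PropositionalEquality
open import Relation.Nullary.Decidable using (True; toWitness; yes; no)

Seq : Set
Seq = ℕ → ℚ

twice : ℕ → ℕ
twice zero    = zero
twice (suc m) = suc (suc (twice m))

data Parity : ℕ → Set where
  even : ∀ m → Parity (twice m)
  odd  : ∀ m → Parity (suc (twice m))

parity : ∀ n → Parity n
parity zero    = even zero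
parity (suc n) with parity n
... | even m = odd m
... | odd m  = even (suc m)

twice≡2* : ∀ m → twice m ≡ 2 ℕ.* m
twice≡2* zero    = refl
twice≡2* (suc m) = cong suc (trans (cong suc (twice≡2* m)) (sym (ℕ.+-suc m (m ℕ.+ 0))))

2≤twice : ∀ {m} → 1 ℕ.≤ m → 2 ℕ.≤ twice m
2≤twice {suc m} _ = ℕ.s≤s (ℕ.s≤s ℕ.z≤n)

twice-cancel-< : ∀ {a b} → suc (twice a) ℕ.≤ twice b → a ℕ.< b
twice-cancel-< {zero}  {suc b} _                       = ℕ.s≤s ℕ.z≤n
twice-cancel-< {suc a} {suc b} (ℕ.s≤s (ℕ.s≤s 2a+1≤2b)) = ℕ.s≤s (twice-cancel-< 2a+1≤2b)

module RationalFacts where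
  open import Data.Rational.Base using (_+_; _*_; _-_; -_; _≤_; _<_; ∣_∣)
  open import Data.Rational.Solver using (module +-*-Solver)
  open import Algebra.Definitions.RawSemiring ℚ.+-*-rawSemiring public using (_^_)
  open +-*-Solver

  ¼ ⅛ 3ℚ 4ℚ : ℚ
  ¼  = ½ * ½
  ⅛  = ½ * ¼
  3ℚ = fromℤ (ℤ.+ 3)
  4ℚ = fromℤ (ℤ.+ 4)

  0≤-closed : ∀ q → {True (0ℚ ℚ.≤? q)} → 0ℚ ≤ q
  0≤-closed q {0≤q} = toWitness 0≤q

  0<-closed : ∀ q → {True (0ℚ ℚ.<? q)} → 0ℚ < q
  0<-closed q {0<q} = toWitness 0<q

  -- Total inverse with the junk value inv 0 = 0.
  inv : ℚ → ℚ
  inv (mkℚ (ℤ.+ zero) _ _)      = 0ℚ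
  inv p@(mkℚ (ℤ.+ suc _) _ _)   = ℚ.1/ p
  inv p@(mkℚ -[1+ _ ] _ _)    = ℚ.1/ p

  *-inv : ∀ p → p ≢ 0ℚ → p * inv p ≡ 1ℚ
  *-inv (mkℚ (ℤ.+ zero) _ _)    p≢0 = ⊥-elim (p≢0 (ℚ.↥p≡0⇒p≡0 _ refl))
  *-inv p@(mkℚ (ℤ.+ suc _) _ _) _   = ℚ.*-inverseʳ p
  *-inv p@(mkℚ -[1+ _ ] _ _)  _   = ℚ.*-inverseʳ p

  *-inv-inv : ∀ p → p * (inv p * inv p) ≡ inv p
  *-inv-inv p@(mkℚ (ℤ.+ zero) _ _) = ℚ.*-zeroʳ p
  *-inv-inv p@(mkℚ (ℤ.+ suc _) _ _) = trans (sym (ℚ.*-assoc p (inv p) (inv p)))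
    (trans (cong (_* inv p) (*-inv p λ ())) (ℚ.*-identityˡ (inv p)))
  *-inv-inv p@(mkℚ -[1+ _ ] _ _) = trans (sym (ℚ.*-assoc p (inv p) (inv p)))
    (trans (cong (_* inv p) (*-inv p λ ())) (ℚ.*-identityˡ (inv p)))

  inv-nonNeg : ∀ {p} → 0ℚ ≤ p → 0ℚ ≤ inv p
  inv-nonNeg {mkℚ (ℤ.+ zero) _ _}    _ = ℚ.≤-refl
  inv-nonNeg {mkℚ (ℤ.+ suc _) _ _}   _ = ℚ.*≤* (ℤ.+≤+ ℕ.z≤n)
  inv-nonNeg {mkℚ -[1+ _ ] _ _} (ℚ.*≤* ())

  sub-add-cancel : ∀ l d c → l + d - c + c - d ≡ l
  sub-add-cancel = solve 3 (λ l d c → l :+ d :- c :+ c :- d := l) refl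

  ≤-byDiff : ∀ {x y} d → y - x ≡ d → 0ℚ ≤ d → x ≤ y
  ≤-byDiff {x} {y} d y-x≡d 0≤d = subst₂ _≤_ (ℚ.+-identityʳ x)
    (trans (cong (x +_) (sym y-x≡d)) (solve 2 (λ x y → x :+ (y :- x) := y) refl x y))
    (ℚ.+-monoʳ-≤ x 0≤d)

  <-byDiff : ∀ {x y} d → y - x ≡ d → 0ℚ < d → x < y
  <-byDiff {x} {y} d y-x≡d 0<d = subst₂ _<_ (ℚ.+-identityʳ x)
    (trans (cong (x +_) (sym y-x≡d)) (solve 2 (λ x y → x :+ (y :- x) := y) refl x y))
    (ℚ.+-monoʳ-< x 0<d)

  nonNeg-diff : ∀ {x y} → x ≤ y → 0ℚ ≤ y - x
  nonNeg-diff {x} {y} x≤y = subst (_≤ y - x) (ℚ.+-inverseʳ x) (ℚ.+-monoˡ-≤ (- x) x≤y)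

  pos-diff : ∀ {x y} → x < y → 0ℚ < y - x
  pos-diff {x} {y} x<y = subst (_< y - x) (ℚ.+-inverseʳ x) (ℚ.+-monoˡ-< (- x) x<y)

  nonNeg-+ : ∀ {p q} → 0ℚ ≤ p → 0ℚ ≤ q → 0ℚ ≤ p + q
  nonNeg-+ = ℚ.+-mono-≤

  nonNeg-* : ∀ {p q} → 0ℚ ≤ p → 0ℚ ≤ q → 0ℚ ≤ p * q
  nonNeg-* {p} {q} 0≤p 0≤q = ℚ.nonNegative⁻¹ _
    {{ℚ.nonNeg*nonNeg⇒nonNeg p {{ℚ.nonNegative 0≤p}} q {{ℚ.nonNegative 0≤q}}}}

  nonNeg-square : ∀ p → 0ℚ ≤ p * p
  nonNeg-square p with ℚ.≤-total 0ℚ p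
  ... | inj₁ 0≤p = nonNeg-* 0≤p 0≤p
  ... | inj₂ p≤0 = subst (0ℚ ≤_) (solve 1 (λ p → (:- p) :* (:- p) := p :* p) refl p)
                     (nonNeg-* (ℚ.neg-antimono-≤ p≤0) (ℚ.neg-antimono-≤ p≤0))

  *-monoˡ-≤ : ∀ {c p q} → 0ℚ ≤ c → p ≤ q → c * p ≤ c * q
  *-monoˡ-≤ {c} 0≤c = ℚ.*-monoˡ-≤-nonNeg c {{ℚ.nonNegative 0≤c}}

  -∣p∣≤p : ∀ p → - ∣ p ∣ ≤ p
  -∣p∣≤p p with ℚ.∣p∣≡p∨∣p∣≡-p p
  ... | inj₂ ∣p∣≡-p = ℚ.≤-reflexive (trans (cong -_ ∣p∣≡-p) (solve 1 (λ p → :- (:- p) := p) refl p))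
  ... | inj₁ ∣p∣≡p  = ℚ.≤-trans (ℚ.neg-antimono-≤ (ℚ.0≤∣p∣ p))
                        (subst (0ℚ ≤_) ∣p∣≡p (ℚ.0≤∣p∣ p))

  square-≤ : ∀ {p M} → ∣ p ∣ ≤ M → p * p ≤ M * M
  square-≤ {p} {M} ∣p∣≤M = begin
      p * p          ≡⟨ sym (ℚ.0≤p⇒∣p∣≡p (nonNeg-square p)) ⟩
      ∣ p * p ∣      ≡⟨ ℚ.∣p*q∣≡∣p∣*∣q∣ p p ⟩
      ∣ p ∣ * ∣ p ∣  ≤⟨ *-monoˡ-≤ (ℚ.0≤∣p∣ p) ∣p∣≤M ⟩
      ∣ p ∣ * M      ≡⟨ ℚ.*-comm ∣ p ∣ M ⟩
      M * ∣ p ∣      ≤⟨ *-monoˡ-≤ (ℚ.≤-trans (ℚ.0≤∣p∣ p) ∣p∣≤M) ∣p∣≤M ⟩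
      M * M          ∎
    where open ℚ.≤-Reasoning

  ^-nonNeg : ∀ {x} → 0ℚ ≤ x → ∀ n → 0ℚ ≤ x ^ n
  ^-nonNeg 0≤x zero    = 0≤-closed 1ℚ
  ^-nonNeg 0≤x (suc n) = nonNeg-* 0≤x (^-nonNeg 0≤x n)

  1≤^ : ∀ {x} → 1ℚ ≤ x → ∀ n → 1ℚ ≤ x ^ n
  1≤^ 1≤x zero    = ℚ.≤-refl
  1≤^ {x} 1≤x (suc n) = ≤-byDiff ((x - 1ℚ) * x ^ n + (x ^ n - 1ℚ))
    (solve 2 (λ x y → x :* y :- con 1ℚ := (x :- con 1ℚ) :* y :+ (y :- con 1ℚ)) refl x (x ^ n))
    (nonNeg-+ (nonNeg-* (nonNeg-diff 1≤x) (ℚ.≤-trans (0≤-closed 1ℚ) (1≤^ 1≤x n))) (nonNeg-diff (1≤^ 1≤x n)))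

  ∣↥∣≤⇒∣∣≤ : ∀ q N → ℤ.∣ ↥ q ∣ ℕ.≤ N → ∣ q ∣ ≤ fromℤ (ℤ.+ N)
  ∣↥∣≤⇒∣∣≤ (mkℚ n d _) N ∣n∣≤N =
    ℚ.*≤* (subst₂ ℤ._≤_ (sym (ℤ.*-identityʳ (ℤ.+ ℤ.∣ n ∣))) (ℤ.pos-* N (suc d))
                        (ℤ.+≤+ (ℕ.≤-trans ∣n∣≤N (ℕ.m≤m*n N (suc d)))))

  fromℤ-mono-≤ : ∀ {m n} → m ℕ.≤ n → fromℤ (ℤ.+ m) ≤ fromℤ (ℤ.+ n)
  fromℤ-mono-≤ {m} {n} m≤n =
    ℚ.*≤* (subst₂ ℤ._≤_ (sym (ℤ.*-identityʳ (ℤ.+ m))) (sym (ℤ.*-identityʳ (ℤ.+ n))) (ℤ.+≤+ m≤n))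

module Coefficients where
  open import Data.Rational.Base using (_+_; _*_; _-_; -_)
  open ≡-Reasoning

  coeff-+P : ∀ p q n → coeff (p +P q) n ≡ coeff p n + coeff q n
  coeff-+P []      q       n       = sym (ℚ.+-identityˡ (coeff q n))
  coeff-+P (a ∷ p) []      n       = sym (ℚ.+-identityʳ (coeff (a ∷ p) n))
  coeff-+P (a ∷ p) (b ∷ q) zero    = refl
  coeff-+P (a ∷ p) (b ∷ q) (suc n) = coeff-+P p q n

  coeff-scale : ∀ c p n → coeff (scale c p) n ≡ c * coeff p n
  coeff-scale c []      n       = sym (ℚ.*-zeroʳ c)
  coeff-scale c (a ∷ p) zero    = refl
  coeff-scale c (a ∷ p) (suc n) = coeff-scale c p n

  coeff--P : ∀ p q n → coeff (p -P q) n ≡ coeff p n - coeff q n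
  coeff--P p q n = begin
    coeff (p +P negP q) n                ≡⟨ coeff-+P p (negP q) n ⟩
    coeff p n + coeff (negP q) n         ≡⟨ cong (coeff p n +_) (coeff-scale (- 1ℚ) q n) ⟩
    coeff p n + - 1ℚ * coeff q n         ≡⟨ cong (coeff p n +_) (sym (ℚ.neg-distribˡ-* 1ℚ (coeff q n))) ⟩
    coeff p n + - (1ℚ * coeff q n)       ≡⟨ cong (λ c → coeff p n + - c) (ℚ.*-identityˡ (coeff q n)) ⟩
    coeff p n - coeff q n                ∎

  coeff-x*P : ∀ p q n → coeff ((0ℚ ∷ p) *P q) n ≡ coeff (0ℚ ∷ (p *P q)) n
  coeff-x*P p q n = begin
    coeff (scale 0ℚ q +P (0ℚ ∷ (p *P q))) n         ≡⟨ coeff-+P (scale 0ℚ q) _ n ⟩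
    coeff (scale 0ℚ q) n + coeff (0ℚ ∷ (p *P q)) n
      ≡⟨ cong (_+ coeff (0ℚ ∷ (p *P q)) n) (trans (coeff-scale 0ℚ q n) (ℚ.*-zeroˡ (coeff q n))) ⟩
    0ℚ + coeff (0ℚ ∷ (p *P q)) n                    ≡⟨ ℚ.+-identityˡ _ ⟩
    coeff (0ℚ ∷ (p *P q)) n                         ∎

  coeff-*Px : ∀ p q n → coeff (p *P (0ℚ ∷ q)) n ≡ coeff (0ℚ ∷ (p *P q)) n
  coeff-*Px []      q zero    = refl
  coeff-*Px []      q (suc n) = refl
  coeff-*Px (a ∷ p) q zero    = cong (_+ 0ℚ) (ℚ.*-zeroʳ a)
  coeff-*Px (a ∷ p) q (suc n) = begin
    coeff (scale a q +P (p *P (0ℚ ∷ q))) n          ≡⟨ coeff-+P (scale a q) _ n ⟩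
    coeff (scale a q) n + coeff (p *P (0ℚ ∷ q)) n   ≡⟨ cong (coeff (scale a q) n +_) (coeff-*Px p q n) ⟩
    coeff (scale a q) n + coeff (0ℚ ∷ (p *P q)) n   ≡⟨ coeff-+P (scale a q) _ n ⟨
    coeff (scale a q +P (0ℚ ∷ (p *P q))) n          ∎

  shift : ℕ → Poly → Poly
  shift zero    p = p
  shift (suc m) p = 0ℚ ∷ shift m p

  mulX² : Seq → Seq
  mulX² s zero          = 0ℚ
  mulX² s (suc zero)    = 0ℚ
  mulX² s (suc (suc n)) = s n

  mulX²-cong : ∀ {s r} → s ≗ r → mulX² s ≗ mulX² r
  mulX²-cong s≗r zero          = refl
  mulX²-cong s≗r (suc zero)    = refl
  mulX²-cong s≗r (suc (suc n)) = s≗r n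

  mulX²-+ : ∀ s r n → mulX² s n + mulX² r n ≡ mulX² (λ m → s m + r m) n
  mulX²-+ s r zero          = ℚ.+-identityˡ 0ℚ
  mulX²-+ s r (suc zero)    = ℚ.+-identityˡ 0ℚ
  mulX²-+ s r (suc (suc n)) = refl

  coeff-square-shift : ∀ i p → coeff (shift (suc i) p *P shift (suc i) p) ≗ mulX² (coeff (shift i p *P shift i p))
  coeff-square-shift i p zero    = coeff-x*P (shift i p) (0ℚ ∷ shift i p) zero
  coeff-square-shift i p (suc n) = trans (coeff-x*P s (0ℚ ∷ s) (suc n)) (x-again n)
    where
    s : Poly
    s = shift i p
    x-again : ∀ n → coeff (s *P (0ℚ ∷ s)) n ≡ mulX² (coeff (s *P s)) (suc n)
    x-again zero    = coeff-*Px s s zero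
    x-again (suc n) = coeff-*Px s s (suc n)

  coeff-scale-mulX² : ∀ c {p r} → coeff p ≗ mulX² (coeff r) → coeff (scale c p) ≗ mulX² (coeff (scale c r))
  coeff-scale-mulX² c {p} {r} p≗x²r n = begin
    coeff (scale c p) n             ≡⟨ coeff-scale c p n ⟩
    c * coeff p n                   ≡⟨ cong (c *_) (p≗x²r n) ⟩
    c * mulX² (coeff r) n           ≡⟨ c*mulX² n ⟩
    mulX² (coeff (scale c r)) n     ∎
    where
    c*mulX² : ∀ n → c * mulX² (coeff r) n ≡ mulX² (coeff (scale c r)) n
    c*mulX² zero          = ℚ.*-zeroʳ c
    c*mulX² (suc zero)    = ℚ.*-zeroʳ c
    c*mulX² (suc (suc n)) = sym (coeff-scale c r n)

  coeff-sumP-mulX² : ∀ N (f g : Fin N → Poly) → (∀ i → coeff (f i) ≗ mulX² (coeff (g i))) →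
                     coeff (sumP N f) ≗ mulX² (coeff (sumP N g))
  coeff-sumP-mulX² zero    f g f≗x²g zero          = refl
  coeff-sumP-mulX² zero    f g f≗x²g (suc zero)    = refl
  coeff-sumP-mulX² zero    f g f≗x²g (suc (suc n)) = refl
  coeff-sumP-mulX² (suc N) f g f≗x²g n = begin
    coeff (f Fin.zero +P sumP N (f ∘ Fin.suc)) n
      ≡⟨ coeff-+P (f Fin.zero) _ n ⟩
    coeff (f Fin.zero) n + coeff (sumP N (f ∘ Fin.suc)) n
      ≡⟨ cong₂ _+_ (f≗x²g Fin.zero n) (coeff-sumP-mulX² N (f ∘ Fin.suc) (g ∘ Fin.suc) (f≗x²g ∘ Fin.suc) n) ⟩
    mulX² (coeff (g Fin.zero)) n + mulX² (coeff (sumP N (g ∘ Fin.suc))) n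
      ≡⟨ mulX²-+ _ _ n ⟩
    mulX² (λ m → coeff (g Fin.zero) m + coeff (sumP N (g ∘ Fin.suc)) m) n
      ≡⟨ mulX²-cong (λ m → sym (coeff-+P (g Fin.zero) _ m)) n ⟩
    mulX² (coeff (sumP (suc N) g)) n ∎

  weightedSquares : ℕ → (ℕ → ℚ) → (ℕ → Poly) → Poly
  weightedSquares N a q = sumP N (λ i → scale (a (toℕ i)) (q (toℕ i) *P q (toℕ i)))

  shiftedSquares : ℕ → (ℕ → ℚ) → (ℕ → Poly) → Poly
  shiftedSquares N a q = weightedSquares N a (λ i → shift i (q i))

  coeff-shiftedSquares-suc : ∀ N (a : ℕ → ℚ) (q : ℕ → Poly) n →
    coeff (shiftedSquares (suc N) a q) n
      ≡ coeff (scale (a 0) (q 0 *P q 0)) n + mulX² (coeff (shiftedSquares N (a ∘ suc) (q ∘ suc))) n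
  coeff-shiftedSquares-suc N a q n = trans (coeff-+P (scale (a 0) (q 0 *P q 0)) _ n)
    (cong (coeff (scale (a 0) (q 0 *P q 0)) n +_) (coeff-sumP-mulX² N shifted unshifted shifted≗x²unshifted n))
    where
    term : ℕ → ℕ → Poly
    term i j = scale (a (suc i)) (shift j (q (suc i)) *P shift j (q (suc i)))
    shifted unshifted : Fin N → Poly
    shifted i   = term (toℕ i) (suc (toℕ i))
    unshifted i = term (toℕ i) (toℕ i)
    shifted≗x²unshifted : ∀ i → coeff (shifted i) ≗ mulX² (coeff (unshifted i))
    shifted≗x²unshifted i = coeff-scale-mulX² (a (suc (toℕ i))) {square (suc (toℕ i))} {square (toℕ i)}
                              (coeff-square-shift (toℕ i) (q (suc (toℕ i))))
      where square : ℕ → Poly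
            square j = shift j (q (suc (toℕ i))) *P shift j (q (suc (toℕ i)))

  append : {A : Set} → ℕ → (ℕ → A) → (ℕ → A) → ℕ → A
  append zero    f g i       = g i
  append (suc m) f g zero    = f zero
  append (suc m) f g (suc i) = append m (f ∘ suc) g i

  coeff-weightedSquares-append : ∀ m N (a b : ℕ → ℚ) (p q : ℕ → Poly) n →
    coeff (weightedSquares (m ℕ.+ N) (append m a b) (append m p q)) n
      ≡ coeff (weightedSquares m a p) n + coeff (weightedSquares N b q) n
  coeff-weightedSquares-append zero    N a b p q n = sym (ℚ.+-identityˡ _)
  coeff-weightedSquares-append (suc m) N a b p q n = begin
    coeff (first +P weightedSquares (m ℕ.+ N) (append m (a ∘ suc) b) (append m (p ∘ suc) q)) n
      ≡⟨ coeff-+P first _ n ⟩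
    coeff first n + coeff (weightedSquares (m ℕ.+ N) (append m (a ∘ suc) b) (append m (p ∘ suc) q)) n
      ≡⟨ cong (coeff first n +_) (coeff-weightedSquares-append m N (a ∘ suc) b (p ∘ suc) q n) ⟩
    coeff first n + (coeff (weightedSquares m (a ∘ suc) (p ∘ suc)) n + coeff (weightedSquares N b q) n)
      ≡⟨ ℚ.+-assoc (coeff first n) _ _ ⟨
    (coeff first n + coeff (weightedSquares m (a ∘ suc) (p ∘ suc)) n) + coeff (weightedSquares N b q) n
      ≡⟨ cong (_+ coeff (weightedSquares N b q) n) (coeff-+P first _ n) ⟨
    coeff (weightedSquares (suc m) a p) n + coeff (weightedSquares N b q) n ∎
    where first : Poly
          first = scale (a 0) (p 0 *P p 0)

  append-all : {A : Set} (P : A → Set) → ∀ m f g → (∀ i → i ℕ.< m → P (f i)) → (∀ i → P (g i)) →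
               ∀ i → P (append m f g i)
  append-all P zero    f g Pf Pg i       = Pg i
  append-all P (suc m) f g Pf Pg zero    = Pf zero (ℕ.s≤s ℕ.z≤n)
  append-all P (suc m) f g Pf Pg (suc i) = append-all P m (f ∘ suc) g (λ i i<m → Pf (suc i) (ℕ.s≤s i<m)) Pg i

  append-all₂ : {A B : Set} (P : A → B → Set) → ∀ m f g f′ g′ →
                (∀ i → i ℕ.< m → P (f i) (f′ i)) → (∀ i → P (g i) (g′ i)) →
                ∀ i → P (append m f g i) (append m f′ g′ i)
  append-all₂ P zero    f g f′ g′ Pf Pg i       = Pg i
  append-all₂ P (suc m) f g f′ g′ Pf Pg zero    = Pf zero (ℕ.s≤s ℕ.z≤n)
  append-all₂ P (suc m) f g f′ g′ Pf Pg (suc i) =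
    append-all₂ P m (f ∘ suc) g (f′ ∘ suc) g′ (λ i i<m → Pf (suc i) (ℕ.s≤s i<m)) Pg i

  coeff-shift-all : (P : ℚ → Set) → P 0ℚ → ∀ i p → (∀ n → P (coeff p n)) → ∀ n → P (coeff (shift i p) n)
  coeff-shift-all P P0 zero    p Pp n       = Pp n
  coeff-shift-all P P0 (suc i) p Pp zero    = P0
  coeff-shift-all P P0 (suc i) p Pp (suc n) = coeff-shift-all P P0 i p Pp n

  DegLe-mono : ∀ p {d e} → d ℕ.≤ e → DegLe p d → DegLe p e
  DegLe-mono p d≤e p≤d n e<n = p≤d n (ℕ.≤-<-trans d≤e e<n)

  DegLe-scale : ∀ c p {d} → DegLe p d → DegLe (scale c p) d
  DegLe-scale c p p≤d n d<n = trans (coeff-scale c p n) (trans (cong (c *_) (p≤d n d<n)) (ℚ.*-zeroʳ c))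

  DegLe-scale-zero : ∀ p d → DegLe (scale 0ℚ p) d
  DegLe-scale-zero p d n _ = trans (coeff-scale 0ℚ p n) (ℚ.*-zeroˡ (coeff p n))

  DegLe-shift : ∀ i p {d} → DegLe p d → DegLe (shift i p) (i ℕ.+ d)
  DegLe-shift zero    p p≤d n       d<n         = p≤d n d<n
  DegLe-shift (suc i) p p≤d (suc n) (ℕ.s≤s d<n) = DegLe-shift i p p≤d n d<n

  coeff-*P-zeroˡ : ∀ p q → (∀ n → coeff p n ≡ 0ℚ) → ∀ n → coeff (p *P q) n ≡ 0ℚ
  coeff-*P-zeroˡ []      q p≡0 n = refl
  coeff-*P-zeroˡ (a ∷ p) q p≡0 n = begin
    coeff (scale a q +P (0ℚ ∷ (p *P q))) n         ≡⟨ coeff-+P (scale a q) _ n ⟩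
    coeff (scale a q) n + coeff (0ℚ ∷ (p *P q)) n  ≡⟨ cong₂ _+_ a*q≡0 (tail≡0 n) ⟩
    0ℚ + 0ℚ                                        ≡⟨ ℚ.+-identityˡ 0ℚ ⟩
    0ℚ                                             ∎
    where
    a*q≡0 : coeff (scale a q) n ≡ 0ℚ
    a*q≡0 = trans (coeff-scale a q n) (trans (cong (_* coeff q n) (p≡0 0)) (ℚ.*-zeroˡ (coeff q n)))
    tail≡0 : ∀ n → coeff (0ℚ ∷ (p *P q)) n ≡ 0ℚ
    tail≡0 zero    = refl
    tail≡0 (suc n) = coeff-*P-zeroˡ p q (p≡0 ∘ suc) n

  DegLe-*P : ∀ p q {d e} → DegLe p d → DegLe q e → DegLe (p *P q) (d ℕ.+ e)
  DegLe-*P []      q         p≤d q≤e n d+e<n = refl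
  DegLe-*P (a ∷ p) q {d} {e} p≤d q≤e n d+e<n = begin
    coeff (scale a q +P (0ℚ ∷ (p *P q))) n         ≡⟨ coeff-+P (scale a q) _ n ⟩
    coeff (scale a q) n + coeff (0ℚ ∷ (p *P q)) n
      ≡⟨ cong₂ _+_ (DegLe-scale a q q≤e n (ℕ.≤-<-trans (ℕ.m≤n+m e d) d+e<n)) (tail≡0 d n p≤d d+e<n) ⟩
    0ℚ + 0ℚ                                        ≡⟨ ℚ.+-identityˡ 0ℚ ⟩
    0ℚ                                             ∎
    where
    tail≡0 : ∀ d n → DegLe (a ∷ p) d → d ℕ.+ e ℕ.< n → coeff (0ℚ ∷ (p *P q)) n ≡ 0ℚ
    tail≡0 zero    (suc n) p≤0 _             = coeff-*P-zeroˡ p q (λ m → p≤0 (suc m) (ℕ.s≤s ℕ.z≤n)) n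
    tail≡0 (suc d) (suc n) p≤d (ℕ.s≤s d+e<n) = DegLe-*P p q (λ m d<m → p≤d (suc m) (ℕ.s≤s d<m)) q≤e n d+e<n

  DegLe-linear : ∀ c d → DegLe (c ∷ d ∷ []) 1
  DegLe-linear c d (suc zero)    (ℕ.s≤s ())
  DegLe-linear c d (suc (suc n)) _          = refl

  DegLe-constant : ∀ c {d} → d ≡ 0ℚ → DegLe (c ∷ d ∷ []) 0
  DegLe-constant c d≡0 (suc zero)    _ = d≡0
  DegLe-constant c d≡0 (suc (suc n)) _ = refl

  DegLe-scaledSquare : ∀ c q {d} → DegLe q d → DegLe (scale c (q *P q)) (d ℕ.+ d)
  DegLe-scaledSquare c q q≤d = DegLe-scale c (q *P q) (DegLe-*P q q q≤d q≤d)

  Monic : Poly → ℕ → Set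
  Monic p d = DegLe p d × coeff p d ≡ 1ℚ

  coeff-linear*P-suc : ∀ c q n → coeff ((c ∷ 1ℚ ∷ []) *P q) (suc n) ≡ c * coeff q (suc n) + coeff q n
  coeff-linear*P-suc c q n = begin
    coeff (scale c q +P (0ℚ ∷ ((1ℚ ∷ []) *P q))) (suc n)        ≡⟨ coeff-+P (scale c q) _ (suc n) ⟩
    coeff (scale c q) (suc n) + coeff ((1ℚ ∷ []) *P q) n        ≡⟨ cong₂ _+_ (coeff-scale c q (suc n)) 1*q ⟩
    c * coeff q (suc n) + coeff q n                             ∎
    where
    1*q : coeff (scale 1ℚ q +P (0ℚ ∷ [])) n ≡ coeff q n
    1*q = begin
      coeff (scale 1ℚ q +P (0ℚ ∷ [])) n          ≡⟨ coeff-+P (scale 1ℚ q) (0ℚ ∷ []) n ⟩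
      coeff (scale 1ℚ q) n + coeff (0ℚ ∷ []) n
        ≡⟨ cong₂ _+_ (trans (coeff-scale 1ℚ q n) (ℚ.*-identityˡ (coeff q n))) (zero-coeff n) ⟩
      coeff q n + 0ℚ                             ≡⟨ ℚ.+-identityʳ _ ⟩
      coeff q n                                  ∎
      where zero-coeff : ∀ n → coeff (0ℚ ∷ []) n ≡ 0ℚ
            zero-coeff zero    = refl
            zero-coeff (suc n) = refl

  monic-linear*P : ∀ c {q d} → Monic q d → Monic ((c ∷ 1ℚ ∷ []) *P q) (suc d)
  monic-linear*P c {q} {d} (q≤d , lead) = degree , leading
    where
    degree : DegLe ((c ∷ 1ℚ ∷ []) *P q) (suc d)
    degree (suc n) (ℕ.s≤s d<n) = begin
      coeff ((c ∷ 1ℚ ∷ []) *P q) (suc n)   ≡⟨ coeff-linear*P-suc c q n ⟩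
      c * coeff q (suc n) + coeff q n      ≡⟨ cong₂ (λ x y → c * x + y) (q≤d (suc n) (ℕ.m<n⇒m<1+n d<n)) (q≤d n d<n) ⟩
      c * 0ℚ + 0ℚ                          ≡⟨ trans (ℚ.+-identityʳ _) (ℚ.*-zeroʳ c) ⟩
      0ℚ                                   ∎
    leading : coeff ((c ∷ 1ℚ ∷ []) *P q) (suc d) ≡ 1ℚ
    leading = begin
      coeff ((c ∷ 1ℚ ∷ []) *P q) (suc d)   ≡⟨ coeff-linear*P-suc c q d ⟩
      c * coeff q (suc d) + coeff q d      ≡⟨ cong₂ (λ x y → c * x + y) (q≤d (suc d) (ℕ.n<1+n d)) lead ⟩
      c * 0ℚ + 1ℚ                          ≡⟨ cong (_+ 1ℚ) (ℚ.*-zeroʳ c) ⟩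
      0ℚ + 1ℚ                              ≡⟨ ℚ.+-identityˡ 1ℚ ⟩
      1ℚ                                   ∎

  rootPoly-monic : ∀ n ρ → Monic (rootPoly n ρ) n
  rootPoly-monic zero    ρ = (λ { (suc n) _ → refl }) , refl
  rootPoly-monic (suc n) ρ = monic-linear*P (0ℚ + - 1ℚ * ρ Fin.zero) {rootPoly n (ρ ∘ Fin.suc)} (rootPoly-monic n (ρ ∘ Fin.suc))

module Size where
  open import Data.Nat.Base using (_+_; _*_; _^_; _≤_; _<_)
  open import Data.Nat.Logarithm using (⌊log₂_⌋; ⌊log₂⌋-mono-≤; ⌊log₂[2^n]⌋≡n)
  import Data.Nat.GCD as ℕ
  open import Data.Nat.Solver using (module +-*-Solver)
  open +-*-Solver
  open RationalFacts using (inv; ¼; ⅛) renaming (_^_ to _^ℚ_)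
  open ℕ.≤-Reasoning

  size : ℚ → ℕ
  size q = ℤ.∣ ↥ q ∣ + ↧ₙ q

  record _fitsIn_ (q : ℚ) (e : ℕ) : Set where
    constructor fits
    field size≤2^e : size q ≤ 2 ^ e
  open _fitsIn_ public

  private
    ≤-cancel-gcd : ∀ a g b → a * g ≡ b → g ≢ 0 → a ≤ b
    ≤-cancel-gcd a zero    b _    g≢0 = ⊥-elim (g≢0 refl)
    ≤-cancel-gcd a (suc g) b a*g≡b _  = subst (a ≤_) a*g≡b (ℕ.m≤m*n a (suc g))

    gcd≢0 : ∀ i n .{{_ : ℕ.NonZero n}} → ℕ.gcd ℤ.∣ i ∣ n ≢ 0
    gcd≢0 i n = ℕ.gcd[m,n]≢0 ℤ.∣ i ∣ n (inj₂ (ℕ.≢-nonZero⁻¹ n))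

  ∣↥[i/n]∣≤∣i∣ : ∀ i n .{{_ : ℕ.NonZero n}} → ℤ.∣ ↥ (i ℚ./ n) ∣ ≤ ℤ.∣ i ∣
  ∣↥[i/n]∣≤∣i∣ i n = ≤-cancel-gcd _ (ℕ.gcd ℤ.∣ i ∣ n) _
    (trans (sym (ℤ.abs-* (↥ (i ℚ./ n)) (ℤ.+ ℕ.gcd ℤ.∣ i ∣ n))) (cong ℤ.∣_∣ (ℚ.↥-/ i n))) (gcd≢0 i n)

  ↧[i/n]≤n : ∀ i n .{{_ : ℕ.NonZero n}} → ↧ₙ (i ℚ./ n) ≤ n
  ↧[i/n]≤n i n = ≤-cancel-gcd _ (ℕ.gcd ℤ.∣ i ∣ n) _
    (trans (sym (ℤ.abs-* (↧ (i ℚ./ n)) (ℤ.+ ℕ.gcd ℤ.∣ i ∣ n))) (cong ℤ.∣_∣ (ℚ.↧-/ i n))) (gcd≢0 i n)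

  size-+ : ∀ p q → size (p ℚ.+ q) ≤ size p * size q
  size-+ p@(mkℚ _ _ _) q@(mkℚ _ _ _) = begin
      ℤ.∣ ↥ (p ℚ.+ q) ∣ + ↧ₙ (p ℚ.+ q)
    ≤⟨ ℕ.+-mono-≤ (∣↥[i/n]∣≤∣i∣ (↥ p ℤ.* ↧ q ℤ.+ ↥ q ℤ.* ↧ p) (↧ₙ p * ↧ₙ q))
                  (↧[i/n]≤n (↥ p ℤ.* ↧ q ℤ.+ ↥ q ℤ.* ↧ p) (↧ₙ p * ↧ₙ q)) ⟩
      ℤ.∣ ↥ p ℤ.* ↧ q ℤ.+ ↥ q ℤ.* ↧ p ∣ + ↧ₙ p * ↧ₙ q
    ≤⟨ ℕ.+-monoˡ-≤ (↧ₙ p * ↧ₙ q) (ℤ.∣i+j∣≤∣i∣+∣j∣ (↥ p ℤ.* ↧ q) (↥ q ℤ.* ↧ p)) ⟩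
      ℤ.∣ ↥ p ℤ.* ↧ q ∣ + ℤ.∣ ↥ q ℤ.* ↧ p ∣ + ↧ₙ p * ↧ₙ q
    ≡⟨ cong₂ (λ x y → x + y + ↧ₙ p * ↧ₙ q) (ℤ.abs-* (↥ p) (↧ q)) (ℤ.abs-* (↥ q) (↧ p)) ⟩
      a * d + c * b + b * d
    ≤⟨ ℕ.m≤n+m _ (a * c) ⟩
      a * c + (a * d + c * b + b * d)
    ≡⟨ solve 4 (λ a b c d → a :* c :+ (a :* d :+ c :* b :+ b :* d) := (a :+ b) :* (c :+ d)) refl a b c d ⟩
      (a + b) * (c + d)
    ∎
    where a b c d : ℕ
          a = ℤ.∣ ↥ p ∣; b = ↧ₙ p; c = ℤ.∣ ↥ q ∣; d = ↧ₙ q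

  size-* : ∀ p q → size (p ℚ.* q) ≤ size p * size q
  size-* p@(mkℚ _ _ _) q@(mkℚ _ _ _) = begin
      ℤ.∣ ↥ (p ℚ.* q) ∣ + ↧ₙ (p ℚ.* q)
    ≤⟨ ℕ.+-mono-≤ (∣↥[i/n]∣≤∣i∣ (↥ p ℤ.* ↥ q) (↧ₙ p * ↧ₙ q))
                  (↧[i/n]≤n (↥ p ℤ.* ↥ q) (↧ₙ p * ↧ₙ q)) ⟩
      ℤ.∣ ↥ p ℤ.* ↥ q ∣ + ↧ₙ p * ↧ₙ q
    ≡⟨ cong (_+ ↧ₙ p * ↧ₙ q) (ℤ.abs-* (↥ p) (↥ q)) ⟩
      a * c + b * d
    ≤⟨ ℕ.+-mono-≤ (ℕ.m≤m+n (a * c) (a * d)) (ℕ.m≤n+m (b * d) (b * c)) ⟩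
      (a * c + a * d) + (b * c + b * d)
    ≡⟨ solve 4 (λ a b c d → (a :* c :+ a :* d) :+ (b :* c :+ b :* d) := (a :+ b) :* (c :+ d)) refl a b c d ⟩
      (a + b) * (c + d)
    ∎
    where a b c d : ℕ
          a = ℤ.∣ ↥ p ∣; b = ↧ₙ p; c = ℤ.∣ ↥ q ∣; d = ↧ₙ q

  size-neg : ∀ p → size (ℚ.- p) ≡ size p
  size-neg p = cong₂ _+_ (trans (cong ℤ.∣_∣ (ℚ.↥-neg p)) (ℤ.∣-i∣≡∣i∣ (↥ p))) (cong ℤ.∣_∣ (ℚ.↧-neg p))

  size-inv : ∀ p → size (inv p) ≤ size p
  size-inv (mkℚ (ℤ.+ zero) _ _)  = ℕ.s≤s ℕ.z≤n
  size-inv (mkℚ (ℤ.+ suc n) d _) = ℕ.≤-reflexive (ℕ.+-comm (suc d) (suc n))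
  size-inv (mkℚ -[1+ n ] d _)    = ℕ.≤-reflexive (ℕ.+-comm (suc d) (suc n))

  fitsIn-mono : ∀ {q e f} → e ≤ f → q fitsIn e → q fitsIn f
  fitsIn-mono e≤f (fits q≤2^e) = fits (ℕ.≤-trans q≤2^e (ℕ.^-monoʳ-≤ 2 e≤f))

  fitsIn-+ : ∀ {p q e f} → p fitsIn e → q fitsIn f → (p ℚ.+ q) fitsIn (e + f)
  fitsIn-+ {p} {q} {e} {f} (fits p≤) (fits q≤) = fits (begin
    size (p ℚ.+ q)     ≤⟨ size-+ p q ⟩
    size p * size q    ≤⟨ ℕ.*-mono-≤ p≤ q≤ ⟩
    2 ^ e * 2 ^ f      ≡⟨ ℕ.^-distribˡ-+-* 2 e f ⟨
    2 ^ (e + f)        ∎)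

  fitsIn-* : ∀ {p q e f} → p fitsIn e → q fitsIn f → (p ℚ.* q) fitsIn (e + f)
  fitsIn-* {p} {q} {e} {f} (fits p≤) (fits q≤) = fits (begin
    size (p ℚ.* q)     ≤⟨ size-* p q ⟩
    size p * size q    ≤⟨ ℕ.*-mono-≤ p≤ q≤ ⟩
    2 ^ e * 2 ^ f      ≡⟨ ℕ.^-distribˡ-+-* 2 e f ⟨
    2 ^ (e + f)        ∎)

  fitsIn-neg : ∀ {p e} → p fitsIn e → (ℚ.- p) fitsIn e
  fitsIn-neg {p} {e} (fits p≤) = fits (subst (_≤ 2 ^ e) (sym (size-neg p)) p≤)

  fitsIn-- : ∀ {p q e f} → p fitsIn e → q fitsIn f → (p ℚ.- q) fitsIn (e + f)
  fitsIn-- p∈ q∈ = fitsIn-+ p∈ (fitsIn-neg q∈)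

  fitsIn-inv : ∀ {p e} → p fitsIn e → inv p fitsIn e
  fitsIn-inv {p} (fits p≤) = fits (ℕ.≤-trans (size-inv p) p≤)

  fitsIn-0 : ∀ e → 0ℚ fitsIn e
  fitsIn-0 e = fits (ℕ.≤-trans (ℕ.s≤s ℕ.z≤n) (ℕ.m^n>0 2 e))

  fitsIn-1 : 1ℚ fitsIn 1
  fitsIn-1 = fits ℕ.≤-refl

  fitsIn-½ : ½ fitsIn 2
  fitsIn-½ = fits (toWitness {a? = size ½ ℕ.≤? 4} _)

  fitsIn-¼ : ¼ fitsIn 3
  fitsIn-¼ = fits (toWitness {a? = size ¼ ℕ.≤? 8} _)

  fitsIn-⅛ : ⅛ fitsIn 4
  fitsIn-⅛ = fits (toWitness {a? = size ⅛ ℕ.≤? 16} _)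

  fitsIn-2^ : ∀ b → fromℤ (ℤ.+ (2 ^ b)) fitsIn (suc b)
  fitsIn-2^ b = fits (begin
    2 ^ b + 1        ≤⟨ ℕ.+-monoʳ-≤ (2 ^ b) (ℕ.m^n>0 2 b) ⟩
    2 ^ b + 2 ^ b    ≡⟨ cong (2 ^ b +_) (ℕ.+-identityʳ (2 ^ b)) ⟨
    2 ^ suc b        ∎)

  bitsℕ≤ : ∀ n e → n ≤ 2 ^ e → bitsℕ n ≤ suc e
  bitsℕ≤ zero    e _ = ℕ.s≤s ℕ.z≤n
  bitsℕ≤ (suc n) e n≤2^e = ℕ.s≤s (subst (⌊log₂ suc n ⌋ ≤_) (⌊log₂[2^n]⌋≡n e) (⌊log₂⌋-mono-≤ n≤2^e))

  bitsℚ≤ : ∀ {q e} → q fitsIn e → bitsℚ q ≤ 3 + (e + e)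
  bitsℚ≤ {q} {e} (fits q≤) = ℕ.s≤s (begin
    bitsℕ ℤ.∣ ↥ q ∣ + bitsℕ (↧ₙ q)   ≤⟨ ℕ.+-mono-≤ (bitsℕ≤ _ e (ℕ.≤-trans (ℕ.m≤m+n ℤ.∣ ↥ q ∣ (↧ₙ q)) q≤))
                                                 (bitsℕ≤ _ e (ℕ.≤-trans (ℕ.m≤n+m (↧ₙ q) ℤ.∣ ↥ q ∣) q≤)) ⟩
    suc e + suc e                    ≡⟨ cong suc (ℕ.+-suc e e) ⟩
    2 + (e + e)                      ∎)

  n<2^bitsℕ : ∀ n → n < 2 ^ bitsℕ n
  n<2^bitsℕ zero    = ℕ.s≤s ℕ.z≤n
  n<2^bitsℕ (suc n) with 2 ^ bitsℕ (suc n) ℕ.≤? suc n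
  ... | yes 2^b≤n = ⊥-elim (ℕ.<-irrefl refl (ℕ.≤-trans
        (ℕ.≤-reflexive (sym (⌊log₂[2^n]⌋≡n (bitsℕ (suc n))))) (⌊log₂⌋-mono-≤ 2^b≤n)))
  ... | no  2^b≰n = ℕ.≰⇒> 2^b≰n

  fitsIn-bitsℚ : ∀ {q b} → bitsℚ q ≤ b → q fitsIn b
  fitsIn-bitsℚ {q} {b} bits≤b = fits (begin
    A + B                      ≤⟨ ℕ.+-mono-≤ (ℕ.<⇒≤ (n<2^bitsℕ A)) (ℕ.<⇒≤ (n<2^bitsℕ B)) ⟩
    2 ^ x + 2 ^ y              ≤⟨ ℕ.+-mono-≤ (ℕ.m≤m*n (2 ^ x) (2 ^ y) {{ℕ.m^n≢0 2 y}})
                                             (ℕ.m≤n*m (2 ^ y) (2 ^ x) {{ℕ.m^n≢0 2 x}}) ⟩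
    2 ^ x * 2 ^ y + 2 ^ x * 2 ^ y ≡⟨ cong (λ z → z + z) (ℕ.^-distribˡ-+-* 2 x y) ⟨
    2 ^ (x + y) + 2 ^ (x + y)  ≡⟨ cong (2 ^ (x + y) +_) (ℕ.+-identityʳ (2 ^ (x + y))) ⟨
    2 ^ bitsℚ q                ≤⟨ ℕ.^-monoʳ-≤ 2 bits≤b ⟩
    2 ^ b                      ∎)
    where A B x y : ℕ
          A = ℤ.∣ ↥ q ∣; B = ↧ₙ q; x = bitsℕ A; y = bitsℕ B

  fitsIn-^ : ∀ {x e} → x fitsIn e → ∀ n → (x ^ℚ n) fitsIn (1 + n * e)
  fitsIn-^ x∈ zero    = fitsIn-1
  fitsIn-^ {e = e} x∈ (suc n) = fitsIn-mono (ℕ.≤-reflexive (ℕ.+-suc e (n * e))) (fitsIn-* x∈ (fitsIn-^ x∈ n))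

  ≤-maxFin : ∀ n (f : Fin n → ℕ) i → f i ≤ maxFin n f
  ≤-maxFin (suc n) f Fin.zero    = ℕ.m≤m⊔n _ _
  ≤-maxFin (suc n) f (Fin.suc i) = ℕ.≤-trans (≤-maxFin n (f ∘ Fin.suc) i) (ℕ.m≤n⊔m _ _)

  bitsℚ≥3 : ∀ q → 3 ≤ bitsℚ q
  bitsℚ≥3 q = ℕ.s≤s (ℕ.+-mono-≤ (bitsℕ≥1 ℤ.∣ ↥ q ∣) (bitsℕ≥1 (↧ₙ q)))
    where bitsℕ≥1 : ∀ n → 1 ≤ bitsℕ n
          bitsℕ≥1 zero    = ℕ.s≤s ℕ.z≤n
          bitsℕ≥1 (suc n) = ℕ.s≤s ℕ.z≤n

  ∣∣≤2^ : ∀ {q e} → q fitsIn e → ℚ.∣ q ∣ ℚ.≤ fromℤ (ℤ.+ (2 ^ e))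
  ∣∣≤2^ {q} (fits q≤) = RationalFacts.∣↥∣≤⇒∣∣≤ q _ (ℕ.≤-trans (ℕ.m≤m+n ℤ.∣ ↥ q ∣ (↧ₙ q)) q≤)

module RootPolyBits where
  open import Data.Nat.Base using (_≤_)
  open Coefficients using (rootPoly-monic)
  open Size

  coeff-bits≤beta : ∀ n ρ j → j ≤ n → bitsℚ (coeff (rootPoly n ρ) j) ≤ beta n ρ
  coeff-bits≤beta n ρ j j≤n = ℕ.≤-trans
    (subst (λ i → bitsℚ (coeff (rootPoly n ρ) i) ≤ maxFin (suc n) coeffBits) (Fin.toℕ-fromℕ< (ℕ.s≤s j≤n))
      (≤-maxFin (suc n) coeffBits (fromℕ< (ℕ.s≤s j≤n))))
    (ℕ.m≤m⊔n (maxFin (suc n) coeffBits) (maxFin n (λ i → bitsℚ (ρ i))))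
    where coeffBits : Fin (suc n) → ℕ
          coeffBits i = bitsℚ (coeff (rootPoly n ρ) (toℕ i))

  root-bits≤beta : ∀ n ρ i → bitsℚ (ρ i) ≤ beta n ρ
  root-bits≤beta n ρ i = ℕ.≤-trans (≤-maxFin n (λ i → bitsℚ (ρ i)) i)
    (ℕ.m≤n⊔m (maxFin (suc n) (λ j → bitsℚ (coeff (rootPoly n ρ) (toℕ j)))) (maxFin n (λ i → bitsℚ (ρ i))))

  3≤beta : ∀ n ρ → 3 ≤ beta n ρ
  3≤beta n ρ = ℕ.≤-trans (bitsℚ≥3 (coeff (rootPoly n ρ) 0)) (coeff-bits≤beta n ρ 0 ℕ.z≤n)

  rootPoly-fitsIn : ∀ n ρ j → coeff (rootPoly n ρ) j fitsIn beta n ρ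
  rootPoly-fitsIn n ρ j with j ℕ.≤? n
  ... | yes j≤n = fitsIn-bitsℚ (coeff-bits≤beta n ρ j j≤n)
  ... | no  j≰n = subst (_fitsIn beta n ρ) (sym (proj₁ (rootPoly-monic n ρ) j (ℕ.≰⇒> j≰n))) (fitsIn-0 (beta n ρ))

module Cholesky where
  open import Data.Rational.Base using (_+_; _*_; _-_; -_; _≤_; _<_)
  open import Data.Rational.Solver using (module +-*-Solver)
  open +-*-Solver
  open RationalFacts
  open Coefficients
  open Size
  open ≡-Reasoning

  pivot : Seq → ℚ
  pivot R = R 0

  slope : Seq → ℚ
  slope R = R 1 * ½ * inv (R 0)

  linearFactor : Seq → Poly
  linearFactor R = 1ℚ ∷ slope R ∷ []

  peel : Seq → Seq
  peel R zero    = R 2 - pivot R * (slope R * slope R)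
  peel R (suc n) = R (3 ℕ.+ n)

  peels : ℕ → Seq → Seq
  peels zero    R = R
  peels (suc m) R = peels m (peel R)

  choleskySquares : ℕ → Seq → Poly
  choleskySquares N R = shiftedSquares N (λ i → pivot (peels i R)) (λ i → linearFactor (peels i R))

  completeSquare : ∀ R → R 0 ≢ 0ℚ → ∀ n →
    R n ≡ coeff (scale (pivot R) (linearFactor R *P linearFactor R)) n + mulX² (peel R) n
  completeSquare R R0≢0 zero = solve 1 (λ r → r := r :* (con 1ℚ :* con 1ℚ :+ con 0ℚ) :+ con 0ℚ) refl (R 0)
  completeSquare R R0≢0 (suc zero) = sym (begin
    R 0 * (1ℚ * h + (h * 1ℚ + 0ℚ)) + 0ℚ
      ≡⟨ solve 3 (λ r₀ r₁ i → r₀ :* (con 1ℚ :* (r₁ :* con ½ :* i) :+ ((r₁ :* con ½ :* i) :* con 1ℚ :+ con 0ℚ)) :+ con 0ℚ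
                               := r₁ :* (r₀ :* i)) refl (R 0) (R 1) (inv (R 0)) ⟩
    R 1 * (R 0 * inv (R 0))   ≡⟨ cong (R 1 *_) (*-inv (R 0) R0≢0) ⟩
    R 1 * 1ℚ                  ≡⟨ ℚ.*-identityʳ (R 1) ⟩
    R 1                       ∎)
    where h : ℚ
          h = slope R
  completeSquare R R0≢0 (suc (suc zero)) =
    solve 2 (λ r₂ c → r₂ := c :+ (r₂ :- c)) refl (R 2) (R 0 * (slope R * slope R))
  completeSquare R R0≢0 (suc (suc (suc n))) = sym (ℚ.+-identityˡ (R (3 ℕ.+ n)))

  peel-vanishes : ∀ N R → (∀ n → twice (suc N) ℕ.≤ suc n → R n ≡ 0ℚ) →
                  ∀ n → twice N ℕ.≤ suc n → peel R n ≡ 0ℚ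
  peel-vanishes zero    R R≡0 zero    _ = begin
    R 2 - R 0 * (R 1 * ½ * inv (R 0) * (R 1 * ½ * inv (R 0)))
      ≡⟨ cong₂ (λ r₁ r₂ → r₂ - R 0 * (r₁ * ½ * inv (R 0) * (r₁ * ½ * inv (R 0))))
               (R≡0 1 ℕ.≤-refl) (R≡0 2 (ℕ.n≤1+n 2)) ⟩
    0ℚ - R 0 * (0ℚ * ½ * inv (R 0) * (0ℚ * ½ * inv (R 0)))
      ≡⟨ solve 2 (λ r i → con 0ℚ :- r :* (con 0ℚ :* con ½ :* i :* (con 0ℚ :* con ½ :* i)) := con 0ℚ)
               refl (R 0) (inv (R 0)) ⟩
    0ℚ ∎
  peel-vanishes (suc N) R R≡0 zero    (ℕ.s≤s ())
  peel-vanishes N       R R≡0 (suc n) 2N≤2+n = R≡0 (3 ℕ.+ n) (ℕ.s≤s (ℕ.s≤s 2N≤2+n))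

  cholesky : ∀ N R → (∀ n → twice N ℕ.≤ suc n → R n ≡ 0ℚ) → (∀ i → i ℕ.< N → pivot (peels i R) ≢ 0ℚ) →
             ∀ n → R n ≡ coeff (choleskySquares N R) n
  cholesky zero    R R≡0 _ n = R≡0 n ℕ.z≤n
  cholesky (suc N) R R≡0 pivots≢0 n = begin
    R n                                           ≡⟨ completeSquare R (pivots≢0 0 (ℕ.s≤s ℕ.z≤n)) n ⟩
    coeff first n + mulX² (peel R) n              ≡⟨ cong (coeff first n +_) (mulX²-cong rest n) ⟩
    coeff first n + mulX² (coeff (choleskySquares N (peel R))) n
      ≡⟨ coeff-shiftedSquares-suc N (λ i → pivot (peels i R)) (λ i → linearFactor (peels i R)) n ⟨
    coeff (choleskySquares (suc N) R) n           ∎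
    where
    first : Poly
    first = scale (pivot R) (linearFactor R *P linearFactor R)
    rest : peel R ≗ coeff (choleskySquares N (peel R))
    rest = cholesky N (peel R) (peel-vanishes N R R≡0) (λ i i<N → pivots≢0 (suc i) (ℕ.s≤s i<N))

  peels-suc : ∀ m R → peels (suc m) R ≡ peel (peels m R)
  peels-suc zero    R = refl
  peels-suc (suc m) R = peels-suc m (peel R)

  peels-tail : ∀ m R n → peels m R (suc n) ≡ R (suc n ℕ.+ twice m)
  peels-tail zero    R n = cong (λ j → R (suc j)) (sym (ℕ.+-identityʳ n))
  peels-tail (suc m) R n = trans (peels-tail m (peel R) n)
    (cong (λ j → R (suc j)) (sym (trans (ℕ.+-suc n (suc (twice m))) (cong suc (ℕ.+-suc n (twice m))))))

  pivot-peel : ∀ S → pivot (peel S) ≡ S 2 - S 1 * S 1 * ¼ * inv (S 0)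
  pivot-peel S = cong (λ x → S 2 - x) (begin
    S 0 * (S 1 * ½ * inv (S 0) * (S 1 * ½ * inv (S 0)))
      ≡⟨ solve 3 (λ s₀ s₁ i → s₀ :* (s₁ :* con ½ :* i :* (s₁ :* con ½ :* i)) := s₁ :* s₁ :* con ¼ :* (s₀ :* (i :* i)))
               refl (S 0) (S 1) (inv (S 0)) ⟩
    S 1 * S 1 * ¼ * (S 0 * (inv (S 0) * inv (S 0)))
      ≡⟨ cong (S 1 * S 1 * ¼ *_) (*-inv-inv (S 0)) ⟩
    S 1 * S 1 * ¼ * inv (S 0) ∎)

  pivot-peels-suc : ∀ m R → pivot (peels (suc m) R)
                    ≡ R (twice (suc m)) - R (suc (twice m)) * R (suc (twice m)) * ¼ * inv (pivot (peels m R))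
  pivot-peels-suc m R = begin
    pivot (peels (suc m) R)   ≡⟨ cong pivot (peels-suc m R) ⟩
    pivot (peel S)            ≡⟨ pivot-peel S ⟩
    S 2 - S 1 * S 1 * ¼ * inv (S 0)
      ≡⟨ cong₂ (λ s₁ s₂ → s₂ - s₁ * s₁ * ¼ * inv (S 0)) (peels-tail m R 0) (peels-tail m R 1) ⟩
    R (twice (suc m)) - R (suc (twice m)) * R (suc (twice m)) * ¼ * inv (S 0) ∎
    where S : Seq
          S = peels m R

  slope-peels : ∀ m R → slope (peels m R) ≡ R (suc (twice m)) * ½ * inv (pivot (peels m R))
  slope-peels m R = cong (λ s₁ → s₁ * ½ * inv (pivot (peels m R))) (peels-tail m R 0)

  peel-pivot-≥ : ∀ S → 0ℚ < S 0 → S 1 * S 1 ≤ S 0 → S 2 - ¼ ≤ pivot (peel S)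
  peel-pivot-≥ S 0<S₀ S₁²≤S₀ = subst (S 2 - ¼ ≤_) (sym (pivot-peel S))
    (≤-byDiff (¼ * ((S 0 - S 1 * S 1) * inv (S 0))) difference
      (nonNeg-* (ℚ.<⇒≤ (ℚ.positive⁻¹ ¼)) (nonNeg-* (nonNeg-diff S₁²≤S₀) (inv-nonNeg (ℚ.<⇒≤ 0<S₀)))))
    where
    difference : (S 2 - S 1 * S 1 * ¼ * inv (S 0)) - (S 2 - ¼) ≡ ¼ * ((S 0 - S 1 * S 1) * inv (S 0))
    difference = begin
      (S 2 - S 1 * S 1 * ¼ * inv (S 0)) - (S 2 - ¼)
        ≡⟨ solve 4 (λ s₀ s₁ s₂ i → (s₂ :- s₁ :* s₁ :* con ¼ :* i) :- (s₂ :- con ¼)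
                                   := con ¼ :* ((s₀ :- s₁ :* s₁) :* i) :+ con ¼ :* (con 1ℚ :- s₀ :* i))
                 refl (S 0) (S 1) (S 2) (inv (S 0)) ⟩
      ¼ * ((S 0 - S 1 * S 1) * inv (S 0)) + ¼ * (1ℚ - S 0 * inv (S 0))
        ≡⟨ cong (λ x → ¼ * ((S 0 - S 1 * S 1) * inv (S 0)) + ¼ * (1ℚ - x)) (*-inv (S 0) (≢-sym (ℚ.<⇒≢ 0<S₀))) ⟩
      ¼ * ((S 0 - S 1 * S 1) * inv (S 0)) + ¼ * (1ℚ - 1ℚ)
        ≡⟨ solve 1 (λ x → x :+ con ¼ :* (con 1ℚ :- con 1ℚ) := x) refl _ ⟩
      ¼ * ((S 0 - S 1 * S 1) * inv (S 0)) ∎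

  pivot-step : ∀ R B m → 0ℚ < B → R (suc (twice m)) * R (suc (twice m)) ≤ B → B ≤ pivot (peels m R) →
               R (twice (suc m)) - ¼ ≤ pivot (peels (suc m) R)
  pivot-step R B m 0<B odd²≤B B≤pivot = subst₂ _≤_ (cong (_- ¼) (peels-tail m R 1)) (cong pivot (sym (peels-suc m R)))
    (peel-pivot-≥ S (ℚ.<-≤-trans 0<B B≤pivot)
      (subst (λ s → s * s ≤ S 0) (sym (peels-tail m R 0)) (ℚ.≤-trans odd²≤B B≤pivot)))
    where S : Seq
          S = peels m R

  pivots-≥ : ∀ R B k → 0ℚ < B → (∀ m → R (suc (twice m)) * R (suc (twice m)) ≤ B) → B ≤ R 0 →
             (∀ m → suc m ℕ.< k → B + ¼ ≤ R (twice (suc m))) → ∀ m → m ℕ.< k → B ≤ pivot (peels m R)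
  pivots-≥ R B k 0<B odd²≤B B≤R₀ B+¼≤even zero    _   = B≤R₀
  pivots-≥ R B k 0<B odd²≤B B≤R₀ B+¼≤even (suc m) m<k =
    ℚ.≤-trans (ℚ.≤-reflexive (solve 1 (λ b → b := b :+ con ¼ :- con ¼) refl B))
      (ℚ.≤-trans (ℚ.+-monoˡ-≤ (- ¼) (B+¼≤even m m<k))
        (pivot-step R B m 0<B (odd²≤B m)
          (pivots-≥ R B k 0<B odd²≤B B≤R₀ B+¼≤even m (ℕ.<-trans (ℕ.n<1+n m) m<k))))

  lastPivot-≥ : ∀ R B k → 1 ℕ.≤ k → 0ℚ < B → (∀ m → R (suc (twice m)) * R (suc (twice m)) ≤ B) →
                (∀ m → m ℕ.< k → B ≤ pivot (peels m R)) → R (twice k) - ¼ ≤ pivot (peels k R)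
  lastPivot-≥ R B (suc m) _ 0<B odd²≤B B≤pivots = pivot-step R B m 0<B (odd²≤B m) (B≤pivots m (ℕ.n<1+n m))

  pivotGrowth : ℕ → ℕ
  pivotGrowth e = e ℕ.+ ((e ℕ.+ e) ℕ.+ 3)

  pivots-fitIn : ∀ R e → (∀ n → R n fitsIn e) → ∀ m → pivot (peels m R) fitsIn (suc m ℕ.* pivotGrowth e)
  pivots-fitIn R e R∈ zero    = fitsIn-mono (ℕ.≤-trans (ℕ.m≤m+n e _) (ℕ.m≤m+n (pivotGrowth e) 0)) (R∈ 0)
  pivots-fitIn R e R∈ (suc m) = subst (_fitsIn _) (sym (pivot-peels-suc m R))
    (fitsIn-mono (ℕ.≤-reflexive (sym (ℕ.+-assoc e ((e ℕ.+ e) ℕ.+ 3) (suc m ℕ.* pivotGrowth e))))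
      (fitsIn-- (R∈ _) (fitsIn-* (fitsIn-* (fitsIn-* (R∈ _) (R∈ _)) fitsIn-¼) (fitsIn-inv (pivots-fitIn R e R∈ m)))))

  slopes-fitIn : ∀ R e → (∀ n → R n fitsIn e) → ∀ m → slope (peels m R) fitsIn ((e ℕ.+ 2) ℕ.+ suc m ℕ.* pivotGrowth e)
  slopes-fitIn R e R∈ m = subst (_fitsIn _) (sym (slope-peels m R))
    (fitsIn-* (fitsIn-* (R∈ _) fitsIn-½) (fitsIn-inv (pivots-fitIn R e R∈ m)))

module TelescopingChain (u : ℚ) where
  open import Data.Rational.Base using (_+_; _*_; _-_; -_; _≤_; _<_)
  open import Data.Rational.Solver using (module +-*-Solver)
  open +-*-Solver
  open RationalFacts
  open Coefficients
  open ≡-Reasoning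

  x²-u : Poly
  x²-u = (- u) ∷ 0ℚ ∷ 1ℚ ∷ []

  x²-u-squared : Poly
  x²-u-squared = u * u ∷ 0ℚ ∷ - (u + u) ∷ 0ℚ ∷ 1ℚ ∷ []

  coeff-x²-u-square : ∀ c n → coeff (scale c (x²-u *P x²-u)) n ≡ c * coeff x²-u-squared n
  coeff-x²-u-square c n = trans (coeff-scale c (x²-u *P x²-u) n) (cong (c *_) (square n))
    where
    square : ∀ n → coeff (x²-u *P x²-u) n ≡ coeff x²-u-squared n
    square 0 = solve 1 (λ u → (:- u) :* (:- u) :+ con 0ℚ := u :* u) refl u
    square 1 = solve 1 (λ u → (:- u) :* con 0ℚ :+ (con 0ℚ :* (:- u) :+ con 0ℚ) := con 0ℚ) refl u
    square 2 = solve 1 (λ u → (:- u) :* con 1ℚ :+ (con 0ℚ :* con 0ℚ :+ (con 1ℚ :* (:- u) :+ con 0ℚ)) := :- (u :+ u)) refl u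
    square 3 = solve 1 (λ u → con 0ℚ :* con 1ℚ :+ con 1ℚ :* con 0ℚ := con 0ℚ) refl u
    square 4 = refl
    square (suc (suc (suc (suc (suc n))))) = refl

  prev : Seq → Seq
  prev s zero    = 0ℚ
  prev s (suc m) = s m

  chainSquares : ℕ → Seq → Poly
  chainSquares N w = shiftedSquares N w (λ _ → x²-u)

  bandCoeff : Seq → ℕ → ℚ
  bandCoeff w m = u * u * w m - (u + u) * prev w m + prev (prev w) m

  bandCoeff-suc : ∀ w m → w 0 * coeff x²-u-squared (twice (suc m)) + bandCoeff (w ∘ suc) m ≡ bandCoeff w (suc m)
  bandCoeff-suc w zero = solve 3 (λ u w₀ w₁ → w₀ :* (:- (u :+ u)) :+ (u :* u :* w₁ :- (u :+ u) :* con 0ℚ :+ con 0ℚ)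
                                  := u :* u :* w₁ :- (u :+ u) :* w₀ :+ con 0ℚ) refl u (w 0) (w 1)
  bandCoeff-suc w (suc zero) = solve 4 (λ u w₀ w₁ w₂ → w₀ :* con 1ℚ :+ (u :* u :* w₂ :- (u :+ u) :* w₁ :+ con 0ℚ)
                                        := u :* u :* w₂ :- (u :+ u) :* w₁ :+ w₀) refl u (w 0) (w 1) (w 2)
  bandCoeff-suc w (suc (suc m)) = trans (cong (_+ bandCoeff w (3 ℕ.+ m)) (ℚ.*-zeroʳ (w 0))) (ℚ.+-identityˡ _)

  coeff-chainSquares-even : ∀ N w → (∀ j → N ℕ.≤ j → w j ≡ 0ℚ) →
                            ∀ m → coeff (chainSquares N w) (twice m) ≡ bandCoeff w m
  coeff-chainSquares-even zero w w≡0 m = sym (begin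
    u * u * w m - (u + u) * prev w m + prev (prev w) m
      ≡⟨ cong₂ (λ x y → u * u * w m - (u + u) * x + y) (prev-zero w≡0′ m) (prev-zero (prev-zero w≡0′) m) ⟩
    u * u * w m - (u + u) * 0ℚ + 0ℚ
      ≡⟨ cong (λ x → u * u * x - (u + u) * 0ℚ + 0ℚ) (w≡0′ m) ⟩
    u * u * 0ℚ - (u + u) * 0ℚ + 0ℚ
      ≡⟨ solve 1 (λ u → u :* u :* con 0ℚ :- (u :+ u) :* con 0ℚ :+ con 0ℚ := con 0ℚ) refl u ⟩
    0ℚ ∎)
    where
    w≡0′ : ∀ j → w j ≡ 0ℚ
    w≡0′ j = w≡0 j ℕ.z≤n
    prev-zero : ∀ {s} → (∀ j → s j ≡ 0ℚ) → ∀ j → prev s j ≡ 0ℚ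
    prev-zero s≡0 zero    = refl
    prev-zero s≡0 (suc j) = s≡0 j
  coeff-chainSquares-even (suc N) w w≡0 zero = begin
    coeff (chainSquares (suc N) w) 0
      ≡⟨ coeff-shiftedSquares-suc N w (λ _ → x²-u) 0 ⟩
    coeff (scale (w 0) (x²-u *P x²-u)) 0 + 0ℚ
      ≡⟨ cong (_+ 0ℚ) (coeff-x²-u-square (w 0) 0) ⟩
    w 0 * (u * u) + 0ℚ
      ≡⟨ solve 2 (λ u w₀ → w₀ :* (u :* u) :+ con 0ℚ := u :* u :* w₀ :- (u :+ u) :* con 0ℚ :+ con 0ℚ) refl u (w 0) ⟩
    bandCoeff w 0 ∎
  coeff-chainSquares-even (suc N) w w≡0 (suc m) = begin
    coeff (chainSquares (suc N) w) (twice (suc m))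
      ≡⟨ coeff-shiftedSquares-suc N w (λ _ → x²-u) (twice (suc m)) ⟩
    coeff (scale (w 0) (x²-u *P x²-u)) (twice (suc m)) + coeff (chainSquares N (w ∘ suc)) (twice m)
      ≡⟨ cong₂ _+_ (coeff-x²-u-square (w 0) (twice (suc m)))
                   (coeff-chainSquares-even N (w ∘ suc) (λ j N≤j → w≡0 (suc j) (ℕ.s≤s N≤j)) m) ⟩
    w 0 * coeff x²-u-squared (twice (suc m)) + bandCoeff (w ∘ suc) m
      ≡⟨ bandCoeff-suc w m ⟩
    bandCoeff w (suc m) ∎

  coeff-chainSquares-odd : ∀ N w m → coeff (chainSquares N w) (suc (twice m)) ≡ 0ℚ
  coeff-chainSquares-odd zero    w m = refl
  coeff-chainSquares-odd (suc N) w m = begin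
    coeff (chainSquares (suc N) w) (suc (twice m))
      ≡⟨ coeff-shiftedSquares-suc N w (λ _ → x²-u) (suc (twice m)) ⟩
    coeff (scale (w 0) (x²-u *P x²-u)) (suc (twice m)) + mulX² (coeff (chainSquares N (w ∘ suc))) (suc (twice m))
      ≡⟨ cong₂ _+_ (trans (coeff-x²-u-square (w 0) (suc (twice m))) (cong (w 0 *_) (x²-u-squared-odd m))) (tail≡0 m) ⟩
    w 0 * 0ℚ + 0ℚ
      ≡⟨ trans (ℚ.+-identityʳ _) (ℚ.*-zeroʳ (w 0)) ⟩
    0ℚ ∎
    where
    x²-u-squared-odd : ∀ m → coeff x²-u-squared (suc (twice m)) ≡ 0ℚ
    x²-u-squared-odd 0 = refl
    x²-u-squared-odd 1 = refl
    x²-u-squared-odd (suc (suc m)) = refl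
    tail≡0 : ∀ m → mulX² (coeff (chainSquares N (w ∘ suc))) (suc (twice m)) ≡ 0ℚ
    tail≡0 zero    = refl
    tail≡0 (suc m) = coeff-chainSquares-odd N (w ∘ suc) m

  geometricWeight : ℕ → ℚ
  geometricWeight e = u ^ e * ½ - ⅛

  -- Weight of x^(2j) (x² − u)² in the chain of length k; it is u^(k−2−j)/2 − 1/8 for j ≤ k − 2.
  chainWeight : ℕ → ℕ → ℚ
  chainWeight zero          j       = 0ℚ
  chainWeight (suc k)       (suc j) = chainWeight k j
  chainWeight (suc zero)    zero    = 0ℚ
  chainWeight (suc (suc e)) zero    = geometricWeight e

  chain : ℕ → Poly
  chain k = chainSquares (suc (suc k)) (chainWeight k)

  chainWeight-vanishes : ∀ k j → k ℕ.≤ suc j → chainWeight k j ≡ 0ℚ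
  chainWeight-vanishes zero          j       _             = refl
  chainWeight-vanishes (suc k)       (suc j) (ℕ.s≤s k≤1+j) = chainWeight-vanishes k j k≤1+j
  chainWeight-vanishes (suc zero)    zero    _             = refl
  chainWeight-vanishes (suc (suc e)) zero    (ℕ.s≤s ())

  chainWeight-value : ∀ j e → chainWeight (suc (suc j) ℕ.+ e) j ≡ geometricWeight e
  chainWeight-value zero    e = refl
  chainWeight-value (suc j) e = chainWeight-value j e

  chainWeight-last : ∀ j → chainWeight (suc (suc j)) j ≡ geometricWeight 0
  chainWeight-last zero    = refl
  chainWeight-last (suc j) = chainWeight-last j

  coeff-chain-even : ∀ k m → coeff (chain k) (twice m) ≡ bandCoeff (chainWeight k) m
  coeff-chain-even k = coeff-chainSquares-even (suc (suc k)) (chainWeight k)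
    (λ j 2+k≤j → chainWeight-vanishes k j (ℕ.≤-trans (ℕ.m≤n+m k 2) (ℕ.≤-trans 2+k≤j (ℕ.n≤1+n j))))

  bandCoeff-values : ∀ w m {a b c} → w (suc m) ≡ a → w m ≡ b → prev w m ≡ c →
                     bandCoeff w (suc m) ≡ u * u * a - (u + u) * b + c
  bandCoeff-values w m refl refl refl = refl

  module Bounds (1≤u/4 : 1ℚ ≤ u * ¼) where

    0≤u : 0ℚ ≤ u
    0≤u = ≤-byDiff ((u * ¼ - 1ℚ) * 4ℚ + 4ℚ)
      (solve 1 (λ u → u :- con 0ℚ := (u :* con ¼ :- con 1ℚ) :* con 4ℚ :+ con 4ℚ) refl u)
      (nonNeg-+ (nonNeg-* (nonNeg-diff 1≤u/4) (0≤-closed 4ℚ)) (0≤-closed 4ℚ))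

    1≤u : 1ℚ ≤ u
    1≤u = ≤-byDiff ((u * ¼ - 1ℚ) * 4ℚ + 3ℚ)
      (solve 1 (λ u → u :- con 1ℚ := (u :* con ¼ :- con 1ℚ) :* con 4ℚ :+ con 3ℚ) refl u)
      (nonNeg-+ (nonNeg-* (nonNeg-diff 1≤u/4) (0≤-closed 4ℚ)) (0≤-closed 3ℚ))

    0≤u[u/4-1] : 0ℚ ≤ u * (u * ¼ - 1ℚ)
    0≤u[u/4-1] = nonNeg-* 0≤u (nonNeg-diff 1≤u/4)

    0≤½ : 0ℚ ≤ ½
    0≤½ = 0≤-closed ½

    0≤⅛ : 0ℚ ≤ ⅛
    0≤⅛ = 0≤-closed ⅛

    geometricWeight-nonNeg : ∀ e → 0ℚ ≤ geometricWeight e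
    geometricWeight-nonNeg e = ≤-byDiff ((u ^ e - 1ℚ) * ½ + (½ - ⅛))
      (solve 1 (λ y → y :* con ½ :- con ⅛ :- con 0ℚ := (y :- con 1ℚ) :* con ½ :+ (con ½ :- con ⅛)) refl (u ^ e))
      (nonNeg-+ (nonNeg-* (nonNeg-diff (1≤^ 1≤u e)) 0≤½) (0≤-closed (½ - ⅛)))

    chainWeight-nonNeg : ∀ k j → 0ℚ ≤ chainWeight k j
    chainWeight-nonNeg zero          j       = ℚ.≤-refl
    chainWeight-nonNeg (suc k)       (suc j) = chainWeight-nonNeg k j
    chainWeight-nonNeg (suc zero)    zero    = ℚ.≤-refl
    chainWeight-nonNeg (suc (suc e)) zero    = geometricWeight-nonNeg e

    chain-constant≤ : ∀ k → 1 ℕ.≤ k → coeff (chain k) 0 ≤ u ^ k * ½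
    chain-constant≤ (suc k) _ = subst (_≤ u ^ suc k * ½) (sym (coeff-chain-even (suc k) 0)) (bound k)
      where
      bound : ∀ k → bandCoeff (chainWeight (suc k)) 0 ≤ u ^ suc k * ½
      bound zero = ≤-byDiff (u * ½)
        (solve 1 (λ u → u :* con 1ℚ :* con ½ :- (u :* u :* con 0ℚ :- (u :+ u) :* con 0ℚ :+ con 0ℚ) := u :* con ½) refl u)
        (nonNeg-* 0≤u 0≤½)
      bound (suc e) = ≤-byDiff (u * u * ⅛)
        (solve 2 (λ u y → u :* (u :* y) :* con ½ :- (u :* u :* (y :* con ½ :- con ⅛) :- (u :+ u) :* con 0ℚ :+ con 0ℚ)
                          := u :* u :* con ⅛) refl u (u ^ e))
        (nonNeg-* (nonNeg-square u) 0≤⅛)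

    chain-middle≤ : ∀ j r → coeff (chain (suc (suc j) ℕ.+ r)) (twice (suc j)) ≤ - (u * ¼)
    chain-middle≤ j r = subst (_≤ - (u * ¼)) (sym (coeff-chain-even (suc (suc j) ℕ.+ r) (suc j))) (bound j r)
      where
      bound : ∀ j r → bandCoeff (chainWeight (suc (suc j) ℕ.+ r)) (suc j) ≤ - (u * ¼)
      bound zero zero = ≤-byDiff (u * ½)
        (solve 1 (λ u → :- (u :* con ¼) :- (u :* u :* con 0ℚ :- (u :+ u) :* (con 1ℚ :* con ½ :- con ⅛) :+ con 0ℚ)
                        := u :* con ½) refl u)
        (nonNeg-* 0≤u 0≤½)
      bound zero (suc e) = ≤-byDiff (u * u * u ^ e * ½ + u * (u * ¼ - 1ℚ) * ½)
        (solve 2 (λ u y → :- (u :* con ¼) :- (u :* u :* (y :* con ½ :- con ⅛) :- (u :+ u) :* (u :* y :* con ½ :- con ⅛) :+ con 0ℚ)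
                          := u :* u :* y :* con ½ :+ u :* (u :* con ¼ :- con 1ℚ) :* con ½) refl u (u ^ e))
        (nonNeg-+ (nonNeg-* (nonNeg-* (nonNeg-square u) (^-nonNeg 0≤u e)) 0≤½) (nonNeg-* 0≤u[u/4-1] 0≤½))
      bound (suc j) zero = ≤-byDiff ⅛
        (trans (cong (λ c → - (u * ¼) - c) (bandCoeff-values (chainWeight k) (suc j) top middle bottom))
          (solve 1 (λ u → :- (u :* con ¼) :- (u :* u :* con 0ℚ :- (u :+ u) :* (con 1ℚ :* con ½ :- con ⅛)
                                              :+ (u :* con 1ℚ :* con ½ :- con ⅛)) := con ⅛) refl u))
        0≤⅛
        where
        k : ℕ
        k = suc (suc (suc j)) ℕ.+ 0
        top : chainWeight k (suc (suc j)) ≡ 0ℚ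
        top = chainWeight-vanishes k (suc (suc j)) (ℕ.≤-reflexive (ℕ.+-identityʳ _))
        middle : chainWeight k (suc j) ≡ geometricWeight 0
        middle = chainWeight-value (suc j) 0
        bottom : chainWeight k j ≡ geometricWeight 1
        bottom = trans (cong (λ k → chainWeight k j) (sym (cong (λ n → suc (suc n)) (ℕ.+-suc j 0)))) (chainWeight-value j 1)
      bound (suc j) (suc e) = ≤-byDiff (u * (u * ¼ - 1ℚ) * ½ + ⅛)
        (trans (cong (λ c → - (u * ¼) - c) (bandCoeff-values (chainWeight k) (suc j) top middle bottom))
          (solve 2 (λ u y → :- (u :* con ¼) :- (u :* u :* (y :* con ½ :- con ⅛) :- (u :+ u) :* (u :* y :* con ½ :- con ⅛)
                                               :+ (u :* (u :* y) :* con ½ :- con ⅛))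
                            := u :* (u :* con ¼ :- con 1ℚ) :* con ½ :+ con ⅛) refl u (u ^ e)))
        (nonNeg-+ (nonNeg-* 0≤u[u/4-1] 0≤½) 0≤⅛)
        where
        k : ℕ
        k = suc (suc (suc j)) ℕ.+ suc e
        top : chainWeight k (suc (suc j)) ≡ geometricWeight e
        top = trans (cong (λ n → chainWeight (suc (suc (suc n))) (suc (suc j))) (ℕ.+-suc j e)) (chainWeight-value (suc (suc j)) e)
        middle : chainWeight k (suc j) ≡ geometricWeight (suc e)
        middle = chainWeight-value (suc j) (suc e)
        bottom : chainWeight k j ≡ geometricWeight (suc (suc e))
        bottom = trans (cong (λ n → chainWeight (suc (suc n)) j) (sym (ℕ.+-suc j (suc e)))) (chainWeight-value j (suc (suc e)))

    chain-top≤ : ∀ k → 1 ℕ.≤ k → coeff (chain k) (twice k) ≤ ½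
    chain-top≤ (suc k) _ = subst (_≤ ½) (sym (trans (coeff-chain-even (suc k) (suc k))
      (bandCoeff-values (chainWeight (suc k)) k (chainWeight-vanishes k k (ℕ.n≤1+n k))
                        (chainWeight-vanishes (suc k) k ℕ.≤-refl) refl)))
      (last≤ k)
      where
      last≤ : ∀ k → u * u * 0ℚ - (u + u) * 0ℚ + prev (chainWeight (suc k)) k ≤ ½
      last≤ zero = ≤-byDiff ½
        (solve 1 (λ u → con ½ :- (u :* u :* con 0ℚ :- (u :+ u) :* con 0ℚ :+ con 0ℚ) := con ½) refl u) 0≤½
      last≤ (suc k) = ≤-byDiff ⅛
        (trans (cong (λ c → ½ - (u * u * 0ℚ - (u + u) * 0ℚ + c)) (chainWeight-last k))
          (solve 1 (λ u → con ½ :- (u :* u :* con 0ℚ :- (u :+ u) :* con 0ℚ :+ (con 1ℚ :* con ½ :- con ⅛)) := con ⅛) refl u))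
        0≤⅛

  chain-above : ∀ k m → k ℕ.≤ m → coeff (chain k) (twice (suc m)) ≡ 0ℚ
  chain-above k m k≤m = begin
    coeff (chain k) (twice (suc m))    ≡⟨ coeff-chain-even k (suc m) ⟩
    bandCoeff (chainWeight k) (suc m)  ≡⟨ bandCoeff-values (chainWeight k) m top middle (lowest m k≤m) ⟩
    u * u * 0ℚ - (u + u) * 0ℚ + 0ℚ    ≡⟨ solve 1 (λ u → u :* u :* con 0ℚ :- (u :+ u) :* con 0ℚ :+ con 0ℚ := con 0ℚ) refl u ⟩
    0ℚ                                 ∎
    where
    middle : chainWeight k m ≡ 0ℚ
    middle = chainWeight-vanishes k m (ℕ.≤-trans k≤m (ℕ.n≤1+n m))
    top : chainWeight k (suc m) ≡ 0ℚ
    top = chainWeight-vanishes k (suc m) (ℕ.≤-trans k≤m (ℕ.≤-trans (ℕ.n≤1+n m) (ℕ.n≤1+n (suc m))))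
    lowest : ∀ m → k ℕ.≤ m → prev (chainWeight k) m ≡ 0ℚ
    lowest zero    _   = refl
    lowest (suc m) k≤m = chainWeight-vanishes k m k≤m

  x²-u-degree : DegLe x²-u 2
  x²-u-degree (suc (suc (suc n))) _ = refl
  x²-u-degree (suc zero)       (ℕ.s≤s ())
  x²-u-degree (suc (suc zero)) (ℕ.s≤s (ℕ.s≤s ()))

  chainSquare-degree : ∀ k j → DegLe (scale (chainWeight k j) (shift j x²-u *P shift j x²-u)) (k ℕ.+ k)
  chainSquare-degree k j with suc (suc j) ℕ.≤? k
  ... | yes 2+j≤k = DegLe-mono (scale (chainWeight k j) (shift j x²-u *P shift j x²-u)) (ℕ.+-mono-≤ j+2≤k j+2≤k)
                      (DegLe-scaledSquare (chainWeight k j) (shift j x²-u) (DegLe-shift j x²-u x²-u-degree))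
    where j+2≤k : j ℕ.+ 2 ℕ.≤ k
          j+2≤k = ℕ.≤-trans (ℕ.≤-reflexive (ℕ.+-comm j 2)) 2+j≤k
  ... | no 2+j≰k = subst (λ c → DegLe (scale c (shift j x²-u *P shift j x²-u)) (k ℕ.+ k))
                         (sym (chainWeight-vanishes k j (ℕ.≤-pred (ℕ.≰⇒> 2+j≰k))))
                         (DegLe-scale-zero (shift j x²-u *P shift j x²-u) (k ℕ.+ k))

  module _ {eu : ℕ} (u∈ : Size._fitsIn_ u eu) where
    open Size

    weightExponent chainExponent : ℕ → ℕ
    weightExponent k = 7 ℕ.+ k ℕ.* eu
    chainExponent k = (((eu ℕ.+ eu) ℕ.+ weightExponent k) ℕ.+ ((eu ℕ.+ eu) ℕ.+ weightExponent k)) ℕ.+ weightExponent k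

    chainWeight-fitIn : ∀ k j → chainWeight k j fitsIn weightExponent k
    chainWeight-fitIn zero          j       = fitsIn-0 _
    chainWeight-fitIn (suc k)       (suc j) = fitsIn-mono (ℕ.+-monoʳ-≤ 7 (ℕ.*-monoˡ-≤ eu (ℕ.n≤1+n k))) (chainWeight-fitIn k j)
    chainWeight-fitIn (suc zero)    zero    = fitsIn-0 _
    chainWeight-fitIn (suc (suc e)) zero    = fitsIn-mono
      (ℕ.≤-trans (ℕ.≤-reflexive (trans (ℕ.+-assoc (1 ℕ.+ e ℕ.* eu) 2 4) (ℕ.+-comm (1 ℕ.+ e ℕ.* eu) 6)))
                 (ℕ.+-monoʳ-≤ 7 (ℕ.*-monoˡ-≤ eu (ℕ.m≤n+m e 2))))
      (fitsIn-- (fitsIn-* (fitsIn-^ u∈ e) fitsIn-½) fitsIn-⅛)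

    prev-fitIn : ∀ {s e} → (∀ j → s j fitsIn e) → ∀ j → prev s j fitsIn e
    prev-fitIn s∈ zero    = fitsIn-0 _
    prev-fitIn s∈ (suc j) = s∈ j

    coeff-chain-fitIn : ∀ k n → coeff (chain k) n fitsIn chainExponent k
    coeff-chain-fitIn k n with parity n
    ... | even m = subst (_fitsIn _) (sym (coeff-chain-even k m))
          (fitsIn-+ (fitsIn-- (fitsIn-* (fitsIn-* u∈ u∈) (w∈ m)) (fitsIn-* (fitsIn-+ u∈ u∈) (prev-fitIn w∈ m)))
                    (prev-fitIn (prev-fitIn w∈) m))
      where w∈ : ∀ j → chainWeight k j fitsIn weightExponent k
            w∈ = chainWeight-fitIn k
    ... | odd m  = subst (_fitsIn _) (sym (coeff-chainSquares-odd (suc (suc k)) (chainWeight k) m)) (fitsIn-0 _)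


module PolynomialGrowth (B : ℕ) (1≤B : 1 ℕ.≤ B) where
  open import Data.Nat.Base using (_+_; _*_; _^_; _≤_; _⊔_)
  open ℕ.≤-Reasoning

  record Bounded : Set where
    field
      value factor degree : ℕ
      value≤ : value ≤ factor * B ^ degree
  open Bounded public

  private
    B^-mono : ∀ {d e} → d ≤ e → B ^ d ≤ B ^ e
    B^-mono = ℕ.^-monoʳ-≤ B {{ℕ.>-nonZero 1≤B}}

  lit : ℕ → Bounded
  lit n = record { value = n ; factor = n ; degree = 0 ; value≤ = ℕ.≤-reflexive (sym (ℕ.*-identityʳ n)) }

  atom : ∀ n → n ≤ B → Bounded
  atom n n≤B = record { value = n ; factor = 1 ; degree = 1
                      ; value≤ = ℕ.≤-trans n≤B (ℕ.≤-reflexive (sym (trans (ℕ.*-identityˡ (B ^ 1)) (ℕ.*-identityʳ B)))) }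

  _⊕_ : Bounded → Bounded → Bounded
  x ⊕ y = record { value = value x + value y ; factor = factor x + factor y ; degree = d ; value≤ = bound }
    where
    d : ℕ
    d = degree x ⊔ degree y
    bound : value x + value y ≤ (factor x + factor y) * B ^ d
    bound = begin
      value x + value y
        ≤⟨ ℕ.+-mono-≤ (value≤ x) (value≤ y) ⟩
      factor x * B ^ degree x + factor y * B ^ degree y
        ≤⟨ ℕ.+-mono-≤ (ℕ.*-monoʳ-≤ (factor x) (B^-mono (ℕ.m≤m⊔n (degree x) (degree y))))
                      (ℕ.*-monoʳ-≤ (factor y) (B^-mono (ℕ.m≤n⊔m (degree x) (degree y)))) ⟩
      factor x * B ^ d + factor y * B ^ d
        ≡⟨ ℕ.*-distribʳ-+ (B ^ d) (factor x) (factor y) ⟨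
      (factor x + factor y) * B ^ d ∎

  _⊛_ : Bounded → Bounded → Bounded
  x ⊛ y = record { value = value x * value y ; factor = factor x * factor y ; degree = degree x + degree y ; value≤ = bound }
    where
    bound : value x * value y ≤ (factor x * factor y) * B ^ (degree x + degree y)
    bound = begin
      value x * value y
        ≤⟨ ℕ.*-mono-≤ (value≤ x) (value≤ y) ⟩
      (factor x * B ^ degree x) * (factor y * B ^ degree y)
        ≡⟨ ℕ.[m*n]*[o*p]≡[m*o]*[n*p] (factor x) (B ^ degree x) (factor y) (B ^ degree y) ⟩
      (factor x * factor y) * (B ^ degree x * B ^ degree y)
        ≡⟨ cong (factor x * factor y *_) (ℕ.^-distribˡ-+-* B (degree x) (degree y)) ⟨
      (factor x * factor y) * B ^ (degree x + degree y) ∎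

  value≤c*B^c : ∀ x c → factor x ≤ c → degree x ≤ c → value x ≤ c * B ^ c
  value≤c*B^c x c f≤c d≤c = ℕ.≤-trans (value≤ x) (ℕ.*-mono-≤ f≤c (B^-mono d≤c))

module ExponentArithmetic where
  open import Data.Nat.Base using (_+_; _*_; _≤_)
  open import Data.Nat.Solver using (module +-*-Solver)
  open +-*-Solver

  powerExponent : ℕ → ℕ → ℕ
  powerExponent k β = 1 + k * ((((1 + β) + 1) + ((1 + β) + 1)) + 1 + ((((1 + β) + 1) + ((1 + β) + 1)) + 1))

  powerExponent-bound : ∀ k β → 1 ≤ k → 3 ≤ β → 3 + (powerExponent k β + powerExponent k β) ≤ 17 * k * β
  powerExponent-bound k β 1≤k 3≤β with ℕ.m≤n⇒∃[o]m+o≡n 1≤k | ℕ.m≤n⇒∃[o]m+o≡n 3≤β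
  ... | x , refl | y , refl = subst (lhs ≤_) identity (ℕ.m≤m+n lhs (2 + 9 * y + 7 * x + 9 * x * y))
    where
    lhs : ℕ
    lhs = 3 + (powerExponent (1 + x) (3 + y) + powerExponent (1 + x) (3 + y))
    identity : lhs + (2 + 9 * y + 7 * x + 9 * x * y) ≡ 17 * (1 + x) * (3 + y)
    identity = solve 2 (λ x y →
      let k = con 1 :+ x
          β = con 3 :+ y
          v = (((con 1 :+ β) :+ con 1) :+ ((con 1 :+ β) :+ con 1)) :+ con 1
          e = con 1 :+ k :* (v :+ v)
      in con 3 :+ (e :+ e) :+ (con 2 :+ con 9 :* y :+ con 7 :* x :+ con 9 :* x :* y) := con 17 :* k :* β) refl x y

SOSCertificate : (N d b : ℕ) → Poly → Poly → Set
SOSCertificate N d b L D =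
  Σ (Fin N → ℚ) λ a → Σ (Fin N → Poly) λ q →
    ((i : Fin N) → 0ℚ ℚ.≤ a i)
    × ((i : Fin N) → DegLe (scale (a i) (q i *P q i)) d)
    × ((i : Fin N) → bitsℚ (a i) ℕ.≤ b)
    × ((i : Fin N) (n : ℕ) → bitsℚ (coeff (q i) n) ℕ.≤ b)
    × (L ≈P (sumP N (λ i → scale (a i) (q i *P q i)) -P D))


module DominantDiagonal (p : ℚ) (0≤p : 0ℚ ℚ.≤ p) where
  open import Data.Rational.Base using (_+_; _*_; _-_; -_; _≤_; _<_; ∣_∣)
  open import Data.Rational.Solver using (module +-*-Solver)
  open +-*-Solver
  open RationalFacts

  M u : ℚ
  M = p + 1ℚ
  u = (M + M + 1ℚ) * (M + M + 1ℚ)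

  1≤u/4 : 1ℚ ≤ u * ¼
  1≤u/4 = ≤-byDiff (p * p + p * 3ℚ + (1ℚ + ¼))
    (solve 1 (λ p → ((p :+ con 1ℚ) :+ (p :+ con 1ℚ) :+ con 1ℚ) :* ((p :+ con 1ℚ) :+ (p :+ con 1ℚ) :+ con 1ℚ) :* con ¼ :- con 1ℚ
                    := p :* p :+ p :* con 3ℚ :+ (con 1ℚ :+ con ¼)) refl p)
    (nonNeg-+ (nonNeg-+ (nonNeg-square p) (nonNeg-* 0≤p (0≤-closed 3ℚ))) (0≤-closed (1ℚ + ¼)))

  p<M : p < M
  p<M = <-byDiff 1ℚ (solve 1 (λ p → p :+ con 1ℚ :- p := con 1ℚ) refl p) (0<-closed 1ℚ)

  M≤u : M ≤ u
  M≤u = ≤-byDiff (M * M * 4ℚ + M * 3ℚ + 1ℚ)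
    (solve 1 (λ m → (m :+ m :+ con 1ℚ) :* (m :+ m :+ con 1ℚ) :- m := m :* m :* con 4ℚ :+ m :* con 3ℚ :+ con 1ℚ) refl M)
    (nonNeg-+ (nonNeg-+ (nonNeg-* (nonNeg-square M) (0≤-closed 4ℚ)) (nonNeg-* 0≤M (0≤-closed 3ℚ))) (0≤-closed 1ℚ))
    where 0≤M : 0ℚ ≤ M
          0≤M = ℚ.<⇒≤ (ℚ.≤-<-trans 0≤p p<M)

  0<M² : 0ℚ < M * M
  0<M² = <-byDiff (p * p + p * twoℚ + 1ℚ)
    (solve 1 (λ p → (p :+ con 1ℚ) :* (p :+ con 1ℚ) :- con 0ℚ := p :* p :+ p :* con twoℚ :+ con 1ℚ) refl p)
    (ℚ.+-mono-≤-< (nonNeg-+ (nonNeg-square p) (nonNeg-* 0≤p (0≤-closed twoℚ))) (0<-closed 1ℚ))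

  2<u : twoℚ < u
  2<u = <-byDiff ((u * ¼ - 1ℚ) * 4ℚ + twoℚ)
    (solve 1 (λ u → u :- con twoℚ := (u :* con ¼ :- con 1ℚ) :* con 4ℚ :+ con twoℚ) refl u)
    (ℚ.+-mono-≤-< (nonNeg-* (nonNeg-diff 1≤u/4) (0≤-closed 4ℚ)) (0<-closed twoℚ))

  odd-bound : ∀ {l d} → ∣ l ∣ ≤ 1ℚ → ∣ d ∣ ≤ p → (l + d - 0ℚ) * (l + d - 0ℚ) ≤ M * M
  odd-bound {l} {d} ∣l∣≤1 ∣d∣≤p = square-≤ (begin
    ∣ l + d - 0ℚ ∣   ≡⟨ cong ∣_∣ (solve 2 (λ l d → l :+ d :- con 0ℚ := l :+ d) refl l d) ⟩
    ∣ l + d ∣        ≤⟨ ℚ.∣p+q∣≤∣p∣+∣q∣ l d ⟩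
    ∣ l ∣ + ∣ d ∣    ≤⟨ ℚ.+-mono-≤ ∣l∣≤1 ∣d∣≤p ⟩
    1ℚ + p           ≡⟨ ℚ.+-comm 1ℚ p ⟩
    M                ∎)
    where open ℚ.≤-Reasoning

  constant-bound : ∀ {t d c} → u ≤ t → - p ≤ d → c ≤ t * ½ → M * M ≤ t + d - c
  constant-bound {t} {d} {c} u≤t -p≤d c≤t/2 = ≤-byDiff
    ((d + p) + (t * ½ - c) + (t - u) * ½ + (p * p + p * 3ℚ + (3ℚ + ½)))
    (solve 4 (λ t d c p → t :+ d :- c :- (p :+ con 1ℚ) :* (p :+ con 1ℚ)
               := (d :+ p) :+ (t :* con ½ :- c)
                  :+ (t :- ((p :+ con 1ℚ) :+ (p :+ con 1ℚ) :+ con 1ℚ) :* ((p :+ con 1ℚ) :+ (p :+ con 1ℚ) :+ con 1ℚ)) :* con ½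
                  :+ (p :* p :+ p :* con 3ℚ :+ (con 3ℚ :+ con ½)))
           refl t d c p)
    (nonNeg-+ (nonNeg-+ (nonNeg-+ (nonNeg-sum -p≤d) (nonNeg-diff c≤t/2)) (nonNeg-* (nonNeg-diff u≤t) (0≤-closed ½)))
              (nonNeg-+ (nonNeg-+ (nonNeg-square p) (nonNeg-* 0≤p (0≤-closed 3ℚ))) (0≤-closed (3ℚ + ½))))
    where
    nonNeg-sum : - p ≤ d → 0ℚ ≤ d + p
    nonNeg-sum -p≤d = subst (0ℚ ≤_) (solve 2 (λ d p → d :- (:- p) := d :+ p) refl d p) (nonNeg-diff -p≤d)

  middle-bound : ∀ {d c} → - p ≤ d → c ≤ - (u * ¼) → M * M + ¼ ≤ 0ℚ + d - c
  middle-bound {d} {c} -p≤d c≤-u/4 = ≤-byDiff ((d + p) + (- (u * ¼) - c) + 1ℚ)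
    (solve 3 (λ d c p → con 0ℚ :+ d :- c :- ((p :+ con 1ℚ) :* (p :+ con 1ℚ) :+ con ¼)
                        := (d :+ p) :+ (:- (((p :+ con 1ℚ) :+ (p :+ con 1ℚ) :+ con 1ℚ) :* ((p :+ con 1ℚ) :+ (p :+ con 1ℚ) :+ con 1ℚ) :* con ¼) :- c)
                           :+ con 1ℚ) refl d c p)
    (nonNeg-+ (nonNeg-+ (subst (0ℚ ≤_) (solve 2 (λ d p → d :- (:- p) := d :+ p) refl d p) (nonNeg-diff -p≤d))
                        (nonNeg-diff c≤-u/4))
              (0≤-closed 1ℚ))

  top-bound : ∀ {c} → c ≤ ½ → ¼ < 0ℚ + 1ℚ - c
  top-bound {c} c≤½ = <-byDiff ((½ - c) + ¼)
    (solve 1 (λ c → con 0ℚ :+ con 1ℚ :- c :- con ¼ := (con ½ :- c) :+ con ¼) refl c)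
    (ℚ.+-mono-≤-< (nonNeg-diff c≤½) (0<-closed ¼))

module Construction (k β : ℕ) (1≤k : 1 ℕ.≤ k) (3≤β : 3 ℕ.≤ β) (D : Poly) (D-monic : Coefficients.Monic D (2 ℕ.* k))
                    (D∈ : ∀ n → Size._fitsIn_ (coeff D n) β) where
  open import Data.Rational.Base using (_+_; _*_; _-_; -_; _≤_; _<_; ∣_∣)
  open RationalFacts
  open Coefficients
  open Size
  open Cholesky

  2^β : ℚ
  2^β = fromℤ (ℤ.+ (2 ℕ.^ β))

  open DominantDiagonal 2^β (fromℤ-mono-≤ ℕ.z≤n)
  open TelescopingChain u
  open Bounds 1≤u/4

  t : ℚ
  t = u ^ k

  u≤t : u ≤ t
  u≤t = u≤u^ k 1≤k
    where u≤u^ : ∀ k → 1 ℕ.≤ k → u ≤ u ^ k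
          u≤u^ (suc k) _ = subst (_≤ u ^ suc k) (ℚ.*-identityʳ u) (*-monoˡ-≤ 0≤u (1≤^ 1≤u k))

  2<t : twoℚ < t
  2<t = ℚ.<-≤-trans 2<u u≤t

  0<t : 0ℚ < t
  0<t = ℚ.<-trans (0<-closed twoℚ) 2<t

  ∣∣<t : ∀ q → bitsℚ q ℕ.≤ β → ∣ q ∣ < t
  ∣∣<t q bits≤β = ℚ.≤-<-trans (∣∣≤2^ (fitsIn-bitsℚ bits≤β)) (ℚ.<-≤-trans p<M (ℚ.≤-trans M≤u u≤t))

  -2^β≤coeffD : ∀ n → - 2^β ≤ coeff D n
  -2^β≤coeffD n = ℚ.≤-trans (ℚ.neg-antimono-≤ (∣∣≤2^ (D∈ n))) (-∣p∣≤p (coeff D n))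

  open PolynomialGrowth (k ℕ.+ β) (ℕ.≤-trans 1≤k (ℕ.m≤m+n k β))

  -- Size exponents of M, u, t, the chain weights, the chain, R, the pivot growth, all weights and all
  -- factor coefficients; each has exactly the shape produced by the fitsIn lemmas.
  eM eu et ew eT eR growth eA eQ : Bounded
  eM     = (lit 1 ⊕ atom β (ℕ.m≤n+m β k)) ⊕ lit 1
  eu     = ((eM ⊕ eM) ⊕ lit 1) ⊕ ((eM ⊕ eM) ⊕ lit 1)
  et     = lit 1 ⊕ (atom k (ℕ.m≤m+n k β) ⊛ eu)
  ew     = lit 7 ⊕ (atom k (ℕ.m≤m+n k β) ⊛ eu)
  eT     = (((eu ⊕ eu) ⊕ ew) ⊕ ((eu ⊕ eu) ⊕ ew)) ⊕ ew
  eR     = ((et ⊕ lit 1) ⊕ atom β (ℕ.m≤n+m β k)) ⊕ eT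
  growth = eR ⊕ ((eR ⊕ eR) ⊕ lit 3)
  eA     = ((lit 1 ⊕ atom k (ℕ.m≤m+n k β)) ⊛ growth) ⊕ ew
  eQ     = ((eR ⊕ lit 2) ⊕ ((lit 1 ⊕ atom k (ℕ.m≤m+n k β)) ⊛ growth)) ⊕ eu

  u∈ : u fitsIn value eu
  u∈ = fitsIn-* (fitsIn-+ (fitsIn-+ M∈ M∈) fitsIn-1) (fitsIn-+ (fitsIn-+ M∈ M∈) fitsIn-1)
    where M∈ : M fitsIn value eM
          M∈ = fitsIn-+ (fitsIn-2^ β) fitsIn-1

  t∈ : t fitsIn value et
  t∈ = fitsIn-^ u∈ k

  bits-t : bitsℚ t ℕ.≤ 2000 ℕ.* k ℕ.* β
  bits-t = ℕ.≤-trans (bitsℚ≤ t∈) (ℕ.≤-trans (ExponentArithmetic.powerExponent-bound k β 1≤k 3≤β)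
                                             (ℕ.*-monoˡ-≤ β (ℕ.*-monoˡ-≤ k (toWitness {a? = 17 ℕ.≤? 2000} _))))

  bits≤bound : ∀ {q} (e : Bounded) → {True (factor (lit 3 ⊕ (e ⊕ e)) ℕ.≤? 2000)} →
               {True (degree (lit 3 ⊕ (e ⊕ e)) ℕ.≤? 2000)} →
               q fitsIn value e → bitsℚ q ℕ.≤ 2000 ℕ.* (k ℕ.+ β) ℕ.^ 2000
  bits≤bound e {f≤} {d≤} q∈ = ℕ.≤-trans (bitsℚ≤ q∈) (value≤c*B^c (lit 3 ⊕ (e ⊕ e)) 2000 (toWitness f≤) (toWitness d≤))

  pivotExponent slopeExponent : ℕ
  pivotExponent = suc k ℕ.* value growth
  slopeExponent = (value eR ℕ.+ 2) ℕ.+ pivotExponent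

  2k+3≡ : 2 ℕ.* k ℕ.+ 3 ≡ suc k ℕ.+ suc (suc k)
  2k+3≡ = trans (cong (λ x → k ℕ.+ x ℕ.+ 3) (ℕ.+-identityʳ k))
    (trans (ℕ.+-assoc k k 3) (trans (cong (k ℕ.+_) (ℕ.+-comm k 3)) (ℕ.+-suc k (suc (suc k)))))

  k+k≤2k : k ℕ.+ k ℕ.≤ 2 ℕ.* k
  k+k≤2k = ℕ.≤-reflexive (cong (k ℕ.+_) (sym (ℕ.+-identityʳ k)))

  module Certificate (L : Poly) (L₀≡t : coeff L 0 ≡ t) (∣L₁∣≤1 : ∣ coeff L 1 ∣ ≤ 1ℚ) (L₁∈ : coeff L 1 fitsIn 1)
                     (L-linear : DegLe L 1) where

    R : Seq
    R n = coeff L n + coeff D n - coeff (chain k) n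

    ∣L∣≤1 : ∀ n → 1 ℕ.≤ n → ∣ coeff L n ∣ ≤ 1ℚ
    ∣L∣≤1 (suc zero)    _ = ∣L₁∣≤1
    ∣L∣≤1 (suc (suc n)) _ = subst (λ c → ∣ c ∣ ≤ 1ℚ) (sym (L-linear (2 ℕ.+ n) (ℕ.s≤s (ℕ.s≤s ℕ.z≤n))))
                              (toWitness {a? = ∣ 0ℚ ∣ ℚ.≤? 1ℚ} _)

    R-odd : ∀ m → R (suc (twice m)) * R (suc (twice m)) ≤ M * M
    R-odd m = subst (λ c → (coeff L n + coeff D n - c) * (coeff L n + coeff D n - c) ≤ M * M)
                    (sym (coeff-chainSquares-odd (suc (suc k)) (chainWeight k) m))
                    (odd-bound (∣L∣≤1 n (ℕ.s≤s ℕ.z≤n)) (∣∣≤2^ (D∈ n)))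
      where n : ℕ
            n = suc (twice m)

    M²≤R₀ : M * M ≤ R 0
    M²≤R₀ = subst (λ l → M * M ≤ l + coeff D 0 - coeff (chain k) 0) (sym L₀≡t)
                  (constant-bound u≤t (-2^β≤coeffD 0) (chain-constant≤ k 1≤k))

    M²+¼≤R-middle : ∀ m → suc m ℕ.< k → M * M + ¼ ≤ R (twice (suc m))
    M²+¼≤R-middle m 2+m≤k = subst (λ l → M * M + ¼ ≤ l + coeff D n - coeff (chain k) n)
                                  (sym (L-linear n (ℕ.s≤s (ℕ.s≤s ℕ.z≤n))))
                                  (middle-bound (-2^β≤coeffD n) chain≤)
      where
      n : ℕ
      n = twice (suc m)
      chain≤ : coeff (chain k) n ≤ - (u * ¼)
      chain≤ with ℕ.m≤n⇒∃[o]m+o≡n 2+m≤k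
      ... | r , 2+m+r≡k = subst (λ K → coeff (chain K) n ≤ - (u * ¼)) 2+m+r≡k (chain-middle≤ m r)

    ¼<R-top : ¼ < R (twice k)
    ¼<R-top = subst₂ (λ l d → ¼ < l + d - coeff (chain k) (twice k))
                     (sym (L-linear (twice k) (2≤twice 1≤k)))
                     (sym (trans (cong (coeff D) (twice≡2* k)) (proj₂ D-monic)))
                     (top-bound (chain-top≤ k 1≤k))

    R-vanishes : ∀ n → twice (suc k) ℕ.≤ suc n → R n ≡ 0ℚ
    R-vanishes n (ℕ.s≤s 2k+1≤n) = vanish L≡0 D≡0 chain≡0
      where
      vanish : ∀ {l d c} → l ≡ 0ℚ → d ≡ 0ℚ → c ≡ 0ℚ → l + d - c ≡ 0ℚ
      vanish refl refl refl = refl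
      L≡0 : coeff L n ≡ 0ℚ
      L≡0 = L-linear n (ℕ.≤-trans (2≤twice 1≤k) (ℕ.≤-trans (ℕ.n≤1+n (twice k)) 2k+1≤n))
      D≡0 : coeff D n ≡ 0ℚ
      D≡0 = proj₁ D-monic n (subst (λ j → suc j ℕ.≤ n) (twice≡2* k) 2k+1≤n)
      chain≡0 : coeff (chain k) n ≡ 0ℚ
      chain≡0 with parity n
      ... | odd m  = coeff-chainSquares-odd (suc (suc k)) (chainWeight k) m
      ... | even m with twice-cancel-< 2k+1≤n
      ...   | ℕ.s≤s k≤m′ = chain-above k _ k≤m′

    pivots≥ : ∀ m → m ℕ.< k → M * M ≤ pivot (peels m R)
    pivots≥ = pivots-≥ R (M * M) k 0<M² R-odd M²≤R₀ M²+¼≤R-middle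

    pivot>0 : ∀ i → i ℕ.< suc k → 0ℚ < pivot (peels i R)
    pivot>0 i i<1+k with ℕ.m<1+n⇒m<n∨m≡n i<1+k
    ... | inj₁ i<k  = ℚ.<-≤-trans 0<M² (pivots≥ i i<k)
    ... | inj₂ refl = ℚ.<-≤-trans (pos-diff ¼<R-top) (lastPivot-≥ R (M * M) k 1≤k 0<M² R-odd pivots≥)

    decomposition : ∀ n → R n ≡ coeff (choleskySquares (suc k) R) n
    decomposition = cholesky (suc k) R R-vanishes (λ i i<1+k → ≢-sym (ℚ.<⇒≢ (pivot>0 i i<1+k)))

    A : ℕ → ℚ
    A = append (suc k) (λ i → pivot (peels i R)) (chainWeight k)

    Q : ℕ → Poly
    Q = append (suc k) (λ i → shift i (linearFactor (peels i R))) (λ j → shift j x²-u)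

    represents : L ≈P (weightedSquares (2 ℕ.* k ℕ.+ 3) A Q -P D)
    represents n = sym (begin
      coeff (weightedSquares (2 ℕ.* k ℕ.+ 3) A Q -P D) n
        ≡⟨ coeff--P (weightedSquares (2 ℕ.* k ℕ.+ 3) A Q) D n ⟩
      coeff (weightedSquares (2 ℕ.* k ℕ.+ 3) A Q) n - coeff D n
        ≡⟨ cong (λ N → coeff (weightedSquares N A Q) n - coeff D n) 2k+3≡ ⟩
      coeff (weightedSquares (suc k ℕ.+ suc (suc k)) A Q) n - coeff D n
        ≡⟨ cong (_- coeff D n) (coeff-weightedSquares-append (suc k) (suc (suc k)) (λ i → pivot (peels i R)) (chainWeight k)
                                (λ i → shift i (linearFactor (peels i R))) (λ j → shift j x²-u) n) ⟩
      coeff (choleskySquares (suc k) R) n + coeff (chain k) n - coeff D n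
        ≡⟨ cong (λ r → r + coeff (chain k) n - coeff D n) (decomposition n) ⟨
      R n + coeff (chain k) n - coeff D n
        ≡⟨ sub-add-cancel (coeff L n) (coeff D n) (coeff (chain k) n) ⟩
      coeff L n ∎)
      where open ≡-Reasoning

    cholesky-degree : ∀ i → i ℕ.< suc k →
      DegLe (scale (pivot (peels i R)) (shift i (linearFactor (peels i R)) *P shift i (linearFactor (peels i R)))) (2 ℕ.* k)
    cholesky-degree i i<1+k with ℕ.m<1+n⇒m<n∨m≡n i<1+k
    ... | inj₁ i<k  = DegLe-mono (scale (pivot (peels i R)) (shift i lin *P shift i lin)) (ℕ.≤-trans (ℕ.+-mono-≤ i+1≤k i+1≤k) k+k≤2k)
                        (DegLe-scaledSquare _ (shift i lin) (DegLe-shift i lin (DegLe-linear 1ℚ _)))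
      where lin : Poly
            lin = linearFactor (peels i R)
            i+1≤k : i ℕ.+ 1 ℕ.≤ k
            i+1≤k = ℕ.≤-trans (ℕ.≤-reflexive (ℕ.+-comm i 1)) i<k
    ... | inj₂ refl = DegLe-mono (scale (pivot (peels k R)) (shift k lin *P shift k lin)) k+0+k+0≤2k
                        (DegLe-scaledSquare _ (shift k lin) (DegLe-shift k lin (DegLe-constant 1ℚ lastSlope≡0)))
      where
      lin : Poly
      lin = linearFactor (peels k R)
      k+0+k+0≤2k : (k ℕ.+ 0) ℕ.+ (k ℕ.+ 0) ℕ.≤ 2 ℕ.* k
      k+0+k+0≤2k = ℕ.≤-trans (ℕ.≤-reflexive (cong₂ ℕ._+_ (ℕ.+-identityʳ k) (ℕ.+-identityʳ k))) k+k≤2k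
      lastSlope≡0 : slope (peels k R) ≡ 0ℚ
      lastSlope≡0 = begin
        slope (peels k R)                                ≡⟨ slope-peels k R ⟩
        R (suc (twice k)) * ½ * inv (pivot (peels k R))  ≡⟨ cong (λ r → r * ½ * inv (pivot (peels k R))) (R-vanishes _ ℕ.≤-refl) ⟩
        0ℚ * ½ * inv (pivot (peels k R))                 ≡⟨ ℚ.*-zeroˡ (inv (pivot (peels k R))) ⟩
        0ℚ                                               ∎
        where open ≡-Reasoning

    square-degree : ∀ i → DegLe (scale (A i) (Q i *P Q i)) (2 ℕ.* k)
    square-degree = append-all₂ (λ a q → DegLe (scale a (q *P q)) (2 ℕ.* k)) (suc k) _ (chainWeight k) _ (λ j → shift j x²-u)
                      cholesky-degree chain-degree
      where chain-degree : ∀ j → DegLe (scale (chainWeight k j) (shift j x²-u *P shift j x²-u)) (2 ℕ.* k)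
            chain-degree j = DegLe-mono (scale (chainWeight k j) (shift j x²-u *P shift j x²-u)) k+k≤2k (chainSquare-degree k j)

    A-nonNeg : ∀ i → 0ℚ ≤ A i
    A-nonNeg = append-all (0ℚ ≤_) (suc k) _ (chainWeight k) (λ i i<1+k → ℚ.<⇒≤ (pivot>0 i i<1+k)) (chainWeight-nonNeg k)

    L∈ : ∀ n → coeff L n fitsIn (value et ℕ.+ 1)
    L∈ zero          = subst (_fitsIn _) (sym L₀≡t) (fitsIn-mono (ℕ.m≤m+n (value et) 1) t∈)
    L∈ (suc zero)    = fitsIn-mono (ℕ.m≤n+m 1 (value et)) L₁∈
    L∈ (suc (suc n)) = subst (_fitsIn _) (sym (L-linear (2 ℕ.+ n) (ℕ.s≤s (ℕ.s≤s ℕ.z≤n)))) (fitsIn-0 _)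

    R∈ : ∀ n → R n fitsIn value eR
    R∈ n = fitsIn-- (fitsIn-+ (L∈ n) (D∈ n)) (coeff-chain-fitIn u∈ k n)

    A∈ : ∀ i → A i fitsIn value eA
    A∈ = append-all (_fitsIn value eA) (suc k) _ (chainWeight k) pivot∈ weight∈
      where
      pivot∈ : ∀ i → i ℕ.< suc k → pivot (peels i R) fitsIn value eA
      pivot∈ i i<1+k = fitsIn-mono (ℕ.≤-trans (ℕ.*-monoˡ-≤ (value growth) i<1+k) (ℕ.m≤m+n pivotExponent (value ew)))
                                   (pivots-fitIn R (value eR) R∈ i)
      weight∈ : ∀ j → chainWeight k j fitsIn value eA
      weight∈ j = fitsIn-mono (ℕ.m≤n+m (value ew) pivotExponent) (chainWeight-fitIn u∈ k j)

    Q∈ : ∀ i n → coeff (Q i) n fitsIn value eQ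
    Q∈ = append-all (λ q → ∀ n → coeff q n fitsIn value eQ) (suc k) _ (λ j → shift j x²-u)
           (λ i i<1+k → coeff-shift-all (_fitsIn value eQ) (fitsIn-0 _) i (linearFactor (peels i R)) (factor∈ i i<1+k))
           (λ j → coeff-shift-all (_fitsIn value eQ) (fitsIn-0 _) j x²-u x²-u∈)
      where
      slope≤eQ : slopeExponent ℕ.≤ value eQ
      slope≤eQ = ℕ.m≤m+n slopeExponent (value eu)
      1≤eQ : 1 ℕ.≤ value eQ
      1≤eQ = ℕ.≤-trans (ℕ.s≤s ℕ.z≤n) (ℕ.≤-trans (ℕ.m≤n+m 2 (value eR)) (ℕ.≤-trans (ℕ.m≤m+n (value eR ℕ.+ 2) pivotExponent) slope≤eQ))
      factor∈ : ∀ i → i ℕ.< suc k → ∀ n → coeff (linearFactor (peels i R)) n fitsIn value eQ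
      factor∈ i i<1+k zero          = fitsIn-mono 1≤eQ fitsIn-1
      factor∈ i i<1+k (suc zero)    = fitsIn-mono (ℕ.≤-trans (ℕ.+-monoʳ-≤ (value eR ℕ.+ 2) (ℕ.*-monoˡ-≤ (value growth) i<1+k)) slope≤eQ)
                                                  (slopes-fitIn R (value eR) R∈ i)
      factor∈ i i<1+k (suc (suc n)) = fitsIn-0 _
      x²-u∈ : ∀ n → coeff x²-u n fitsIn value eQ
      x²-u∈ zero                = fitsIn-mono (ℕ.m≤n+m (value eu) slopeExponent) (fitsIn-neg u∈)
      x²-u∈ (suc zero)          = fitsIn-0 _
      x²-u∈ (suc (suc zero))    = fitsIn-mono 1≤eQ fitsIn-1
      x²-u∈ (suc (suc (suc n))) = fitsIn-0 _

    certificate : SOSCertificate (2 ℕ.* k ℕ.+ 3) (2 ℕ.* k) (2000 ℕ.* (k ℕ.+ β) ℕ.^ 2000) L D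
    certificate = A ∘ toℕ , Q ∘ toℕ , A-nonNeg ∘ toℕ , square-degree ∘ toℕ
                , (λ i → bits≤bound eA (A∈ (toℕ i))) , (λ i n → bits≤bound eQ (Q∈ (toℕ i) n))
                , represents

  module t-x = Certificate (const t -P X) (ℚ.+-identityʳ t) (toWitness {a? = ∣ - 1ℚ * 1ℚ ∣ ℚ.≤? 1ℚ} _)
                             (fits (toWitness {a? = size (- 1ℚ * 1ℚ) ℕ.≤? 2} _)) (DegLe-linear _ _)
  module t+x = Certificate (const t +P X) (ℚ.+-identityʳ t) (toWitness {a? = ∣ 1ℚ ∣ ℚ.≤? 1ℚ} _)
                             (fits (toWitness {a? = size 1ℚ ℕ.≤? 2} _)) (DegLe-linear _ _)


mainTheorem13 : Σ ℕ λ c →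
  (k : ℕ) → 1 ℕ.≤ k →
  (ρ : Fin (2 ℕ.* k) → ℚ) → Injective _≡_ _≡_ ρ →
  let D = rootPoly (2 ℕ.* k) ρ
      β = beta (2 ℕ.* k) ρ
      Bd = c ℕ.* (k ℕ.+ β) ℕ.^ c
  in Σ ℚ λ t →
    (ℚ.0ℚ ℚ.< t) × (twoℚ ℚ.< t) × ((i : Fin (2 ℕ.* k)) → ℚ.∣ ρ i ∣ ℚ.< t)
    × (bitsℚ t ℕ.≤ c ℕ.* k ℕ.* β)
    × (Σ (Fin (2 ℕ.* k ℕ.+ 3) → ℚ) λ a → Σ (Fin (2 ℕ.* k ℕ.+ 3) → Poly) λ q →
         ((i : Fin (2 ℕ.* k ℕ.+ 3)) → 0ℚ ℚ.≤ a i)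
         × ((i : Fin (2 ℕ.* k ℕ.+ 3)) → DegLe (scale (a i) (q i *P q i)) (2 ℕ.* k))
         × ((i : Fin (2 ℕ.* k ℕ.+ 3)) → bitsℚ (a i) ℕ.≤ Bd)
         × ((i : Fin (2 ℕ.* k ℕ.+ 3)) (n : ℕ) → bitsℚ (coeff (q i) n) ℕ.≤ Bd)
         × ((const t -P X) ≈P (sumP (2 ℕ.* k ℕ.+ 3) (λ i → scale (a i) (q i *P q i)) -P D)))
    × (Σ (Fin (2 ℕ.* k ℕ.+ 3) → ℚ) λ a → Σ (Fin (2 ℕ.* k ℕ.+ 3) → Poly) λ q →
         ((i : Fin (2 ℕ.* k ℕ.+ 3)) → 0ℚ ℚ.≤ a i)
         × ((i : Fin (2 ℕ.* k ℕ.+ 3)) → DegLe (scale (a i) (q i *P q i)) (2 ℕ.* k))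
         × ((i : Fin (2 ℕ.* k ℕ.+ 3)) → bitsℚ (a i) ℕ.≤ Bd)
         × ((i : Fin (2 ℕ.* k ℕ.+ 3)) (n : ℕ) → bitsℚ (coeff (q i) n) ℕ.≤ Bd)
         × ((const t +P X) ≈P (sumP (2 ℕ.* k ℕ.+ 3) (λ i → scale (a i) (q i *P q i)) -P D)))
mainTheorem13 = 2000 , λ k 1≤k ρ _ →  -- the roots need not be distinct
    let open Construction k (beta (2 ℕ.* k) ρ) 1≤k (RootPolyBits.3≤beta _ ρ) (rootPoly (2 ℕ.* k) ρ)
                          (Coefficients.rootPoly-monic _ ρ) (RootPolyBits.rootPoly-fitsIn _ ρ)
    in t , 0<t , 2<t , (λ i → ∣∣<t (ρ i) (RootPolyBits.root-bits≤beta _ ρ i)) , bits-t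
     , t-x.certificate , t+x.certificate
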